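{- Let $\ell\geq3$ and let $G$ be a $P_\ell$-free graph. Suppose $S\subseteq V(G)$ is such that $|S|/(\ell-1)$ is an integer and $G[S]=\bigcup_{1\leq i\leq\tau}Q_i$, where $Q_1,\dots,Q_\tau$ are symmetric subgraphs of $G$ with $\tau\geq\ell$. If $e(G[S])+e_G(S,V(G)\setminus S)\geq\frac{\ell-2}{2}|S|$, then $e(G[S])+e_G(S,V(G)\setminus S)=\frac{\ell-2}{2}|S|$, and moreover: (i) if $\ell$ is odd, then $Q_i\cong K_{\ell-1}$ for all $1\leq i\leq\tau$ and $e_G(S,V(G)\setminus S)=0$; (ii) if $\ell\geq4$ is even, then either $Q_i\cong K_{\ell-1}$ for all $1\leq i\leq\tau$ and $e_G(S,V(G)\setminus S)=0$, or $Q_i\cong K_1$ for all $1\leq i\leq\tau$ and there are $\frac{\ell-2}{2}$ vertices in $V(G)\setminus S$ each adjacent to the unique vertex of $Q_i$ for every $1\leq i\leq\tau$.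
   Context: Graphs are finite and simple. $P_\ell$ is the path on $\ell$ vertices; $e(H)$ is the number of edges; $G[S]$ is the induced subgraph; $e_G(U,S)$ is the number of edges between disjoint sets $U,S$; $\bigcup$ denotes disjoint union. Induced subgraphs $Q_1,\dots,Q_\tau$ of $G$ are symmetric subgraphs of $G$ if they are connected, pairwise vertex-disjoint, and there are isomorphisms $\psi_j:Q_1\to Q_j$ ($2\leq j\leq\tau$) such that for every $u\in V(Q_1)$ and $v\in V(G)\setminus\bigcup_iV(Q_i)$, $uv\in E(G)$ iff $\psi_j(u)v\in E(G)$. -}

module Defs where

open import Data.Nat using (ℕ; zero; suc; _+_; _*_; _∸_; _≤_; _<_; _≥_)
open import Data.Nat.Divisibility using (_∣_)
open import Data.Bool using (Bool; true; false; _∧_; not; if_then_else_)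
open import Data.Fin using (Fin; toℕ)
open import Data.Fin.Subset using (Subset; _∈_; _∉_; ∣_∣)
open import Data.Fin.Subset.Properties using (_∈?_)
open import Data.List using (List; map; allFin)
open import Data.Nat.ListAction using (sum)
open import Data.Product using (Σ; ∃; _×_; _,_)
open import Data.Sum using (_⊎_)
open import Relation.Nullary using (¬_; Dec; yes; no)
open import Relation.Nullary.Decidable using (⌊_⌋)
open import Relation.Binary.PropositionalEquality using (_≡_; _≢_)
open import Data.Nat.Properties using (_<?_)

record Graph (n : ℕ) : Set where
  field
    adj    : Fin n → Fin n → Bool
    symm   : ∀ u v → adj u v ≡ adj v u
    irrefl : ∀ v → adj v v ≡ false
open Graph public

ΣFin : ∀ {n} → (Fin n → ℕ) → ℕ
ΣFin {n} f = sum (map f (allFin n))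

bit : Bool → ℕ
bit true  = 1
bit false = 0

eIn : ∀ {n} → Graph n → Subset n → ℕ
eIn G S = ΣFin λ u → ΣFin λ v →
  bit (⌊ toℕ u <? toℕ v ⌋ ∧ ⌊ u ∈? S ⌋ ∧ ⌊ v ∈? S ⌋ ∧ adj G u v)

eOut : ∀ {n} → Graph n → Subset n → ℕ
eOut G S = ΣFin λ u → ΣFin λ v →
  bit (⌊ u ∈? S ⌋ ∧ not ⌊ v ∈? S ⌋ ∧ adj G u v)

ContainsPath : ∀ {n} → Graph n → ℕ → Set
ContainsPath {n} G ℓ =
  Σ (Fin ℓ → Fin n) λ f →
    (∀ i j → f i ≡ f j → i ≡ j) ×
    (∀ i j → toℕ j ≡ suc (toℕ i) → adj G (f i) (f j) ≡ true)

PathFree : ∀ {n} → Graph n → ℕ → Set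
PathFree G ℓ = ¬ ContainsPath G ℓ

data Reach {n k} (G : Graph n) (f : Fin k → Fin n) : Fin k → Fin k → Set where
  here : ∀ a → Reach G f a a
  step : ∀ a b c → adj G (f a) (f b) ≡ true → Reach G f b c → Reach G f a c

-- G[image f] is connected (and nonempty: k ≥ 1 is required separately)
ConnectedOn : ∀ {n k} → Graph n → (Fin k → Fin n) → Set
ConnectedOn {k = k} G f = ∀ a b → Reach G f a b

-- Q_1,…,Q_τ are symmetric subgraphs of G, with Q_i the induced subgraph on
-- {φ i a : a ∈ Fin k}, and S = ⋃ V(Q_i).  The isomorphism ψ_j : Q_i → Q_j is
-- φ j ∘ (φ i)⁻¹.
SymmetricFamily : ∀ {n} → Graph n → (τ k : ℕ) → (Fin τ → Fin k → Fin n) → Set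
SymmetricFamily {n} G τ k φ =
    (1 ≤ k)
  × (∀ i a j b → φ i a ≡ φ j b → (i ≡ j × a ≡ b))
  × (∀ i → ConnectedOn G (φ i))
  × (∀ i j a b → adj G (φ i a) (φ i b) ≡ adj G (φ j a) (φ j b))
  × (∀ i j a (v : Fin n) → (∀ i' a' → φ i' a' ≢ v) →
        adj G (φ i a) v ≡ adj G (φ j a) v)

IsUnionOf : ∀ {n τ k} → Subset n → (Fin τ → Fin k → Fin n) → Set
IsUnionOf {n} {τ} {k} S φ = ∀ (v : Fin n) → (v ∈ S → ∃ λ i → ∃ λ a → φ i a ≡ v)
                                         × (∀ i a → φ i a ∈ S)

NoCrossEdges : ∀ {n τ k} → Graph n → (Fin τ → Fin k → Fin n) → Set
NoCrossEdges {τ = τ} {k} G φ = ∀ (i j : Fin τ) (a b : Fin k) → i ≢ j → adj G (φ i a) (φ j b) ≡ false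

AllCliques : ∀ {n τ k} → Graph n → ℕ → Subset n → (Fin τ → Fin k → Fin n) → Set
AllCliques {τ = τ} {k} G ℓ S φ =
  (k ≡ ℓ ∸ 1) × (∀ (i : Fin τ) (a b : Fin k) → a ≢ b → adj G (φ i a) (φ i b) ≡ true)
  × (eOut G S ≡ 0)

module Submission where

-- Let Q = Q₁ have k vertices and let W be the t vertices outside S adjacent to Q; by symmetry they
-- see the same vertices in every copy Qᵢ. Counting copy by copy, 2(e(G[S]) + e(S, V∖S)) equals
-- τ (2e(Q) + 2e(Q, W)), so the hypothesis reads 2e(Q) + 2e(Q, W) ≥ (ℓ - 2) k. As τ ≥ ℓ, any path of Q can
-- be woven through fresh copies and all of W, gaining 2t vertices; so Q has no path on ℓ - 2t vertices
-- and the Erdős–Gallai theorem with its extremal case (by induction, using Posa rotations) gives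
-- 2e(Q) ≤ (ℓ - 2 - 2t) k, while e(Q, W) ≤ t k. Hence everything is tight and the connected Q is a clique
-- on ℓ - 1 - 2t vertices. For t = 0 this is the clique case; for t > 0, weaving Hamiltonian paths of
-- the cliques gives a path on 2k + 2t - 1 vertices, which forces k = 1 and ℓ = 2t + 2.

open import Defs
open import Data.Nat using (ℕ; zero; suc; _+_; _*_; _∸_; _≤_; _≥_; _<_; z≤n; s≤s; >-nonZero)
open import Data.Nat.Properties hiding (_≟_)
open import Data.Nat.ListAction using () renaming (sum to sumˡ)
open import Data.Nat.Tactic.RingSolver using (solve-∀)
open import Algebra.Properties.CommutativeSemigroup *-commutativeSemigroup using () renaming (x∙yz≈y∙xz to *-left-comm)
open import Data.Nat.Divisibility using (_∣_)
open import Algebra.Properties.Semiring.Sum +-*-semiring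
  using (sum; sum-syntax; sum-cong-≗; sum-replicate-zero; ∑-distrib-+; ∑-comm; *-distribˡ-sum; *-distribʳ-sum)
open import Data.Bool using (Bool; true; false; _∧_; not; if_then_else_)
open import Data.Bool.Properties using (∧-conicalˡ; ∧-conicalʳ; ∧-zeroʳ; ¬-not) renaming (_≟_ to _≟ᵇ_)
open import Data.Empty using (⊥; ⊥-elim)
open import Data.Fin using (Fin; zero; suc; toℕ; _≟_; fromℕ<; inject≤; cast)
open import Data.Fin.Properties using (any?; toℕ-injective; toℕ-fromℕ<; toℕ-inject≤; toℕ-cast)
open import Data.Fin.Subset using (Subset; _∉_; ∣_∣)
open import Data.Fin.Subset.Properties using (_∈?_)
open import Data.List using (List; []; _∷_; [_]; _++_; _∷ʳ_; map; length; reverse; lookup; tabulate; take)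
import Data.List.Properties as List
open import Data.List.Relation.Unary.Linked using (Linked; []; [-]; _∷_) renaming (map to Linked-map; tail to Linked-tail)
open import Data.List.Relation.Unary.Linked.Properties using (map⁺)
import Data.Vec as Vec
open Vec using ([]; _∷_)
open import Data.Vec.Properties using ([]=⇒lookup; lookup⇒[]=)
open import Data.Product using (Σ; ∃; _×_; _,_; proj₁; proj₂)
open import Data.Sum using (_⊎_; inj₁; inj₂; [_,_]′)
open import Function using (_∘_; id)
open import Relation.Binary.PropositionalEquality hiding ([_])
open import Relation.Nullary using (¬_; contradiction; Dec; yes; no; ¬?)
open import Relation.Nullary.Decidable using (⌊_⌋; decidable-stable; _×-dec_)

+-≤-equality : ∀ {a b c d} → a ≤ c → b ≤ d → a + b ≡ c + d → a ≡ c × b ≡ d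
+-≤-equality {a} {b} {c} {d} a≤c b≤d eq =
  ≤-antisym a≤c (+-cancelʳ-≤ b c a (≤-trans (+-monoʳ-≤ c b≤d) (≤-reflexive (sym eq)))) ,
  ≤-antisym b≤d (+-cancelˡ-≤ a d b (≤-trans (+-monoˡ-≤ d a≤c) (≤-reflexive (sym eq))))

zero-or-positive : ∀ m → m ≡ 0 ⊎ 1 ≤ m
zero-or-positive zero = inj₁ refl
zero-or-positive (suc _) = inj₂ (s≤s z≤n)

longer-half : ∀ r₁ r₂ p → r₂ ≤ r₁ → 1 ≤ p → suc (r₁ + suc r₂) ≤ 2 * (r₁ + p)
longer-half r₁ r₂ p r₂≤r₁ 1≤p = begin
  suc (r₁ + suc r₂) ≡⟨ shift r₁ r₂ ⟩
  r₁ + r₂ + 2       ≤⟨ +-monoˡ-≤ 2 (+-monoʳ-≤ r₁ r₂≤r₁) ⟩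
  r₁ + r₁ + 2       ≡⟨ double r₁ ⟩
  2 * (r₁ + 1)      ≤⟨ *-monoʳ-≤ 2 (+-monoʳ-≤ r₁ 1≤p) ⟩
  2 * (r₁ + p)      ∎
  where
  open ≤-Reasoning
  shift : ∀ a b → suc (a + suc b) ≡ a + b + 2
  shift = solve-∀
  double : ∀ a → a + a + 2 ≡ 2 * (a + 1)
  double = solve-∀

woven-length-base : ∀ M p → M ≤ 2 * p → M + 4 * 1 ≤ 2 * suc p + 2
woven-length-base M p M≤2p = ≤-trans (+-monoˡ-≤ 4 M≤2p) (≤-reflexive (shift p))
  where
  shift : ∀ p → 2 * p + 4 * 1 ≡ 2 * suc p + 2
  shift = solve-∀

woven-length-step : ∀ M m s r → M + 4 * m ≤ 2 * r + 2 → 1 ≤ s → M + 4 * suc m ≤ 2 * suc (s + r) + 2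
woven-length-step M m s r long 1≤s = begin
  M + 4 * suc m           ≡⟨ e₁ M m ⟩
  M + 4 * m + 4           ≤⟨ +-monoˡ-≤ 4 long ⟩
  2 * r + 2 + 4           ≡⟨ e₂ r ⟩
  2 * r + 2 + (2 * 1 + 2) ≤⟨ +-monoʳ-≤ (2 * r + 2) (+-monoˡ-≤ 2 (*-monoʳ-≤ 2 1≤s)) ⟩
  2 * r + 2 + (2 * s + 2) ≡⟨ e₃ s r ⟩
  2 * suc (s + r) + 2     ∎
  where
  open ≤-Reasoning
  e₁ : ∀ M m → M + 4 * suc m ≡ M + 4 * m + 4
  e₁ = solve-∀
  e₂ : ∀ r → 2 * r + 2 + 4 ≡ 2 * r + 2 + (2 * 1 + 2)
  e₂ = solve-∀
  e₃ : ∀ s r → 2 * r + 2 + (2 * s + 2) ≡ 2 * suc (s + r) + 2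
  e₃ = solve-∀

Fin1-unique : ∀ {m} → m ≡ 0 → (a b : Fin (suc m)) → a ≡ b
Fin1-unique refl zero zero = refl

ΣFin≡sum : ∀ {n} (f : Fin n → ℕ) → ΣFin f ≡ sum f
ΣFin≡sum {n} f = trans (cong sumˡ (List.map-tabulate id f)) (sum-tabulate f)
  where
  sum-tabulate : ∀ {n} (f : Fin n → ℕ) → sumˡ (tabulate f) ≡ sum f
  sum-tabulate {zero} f = refl
  sum-tabulate {suc n} f = cong (f zero +_) (sum-tabulate (f ∘ suc))

sum-const : ∀ n c → ∑[ _ < n ] c ≡ n * c
sum-const zero c = refl
sum-const (suc n) c = cong (c +_) (sum-const n c)

sum-zero : ∀ {n} {f : Fin n → ℕ} → (∀ x → f x ≡ 0) → sum f ≡ 0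
sum-zero {n} f≗0 = trans (sum-cong-≗ f≗0) (sum-replicate-zero n)

sum-mono-≤ : ∀ {n} {f g : Fin n → ℕ} → (∀ x → f x ≤ g x) → sum f ≤ sum g
sum-mono-≤ {zero} f≤g = z≤n
sum-mono-≤ {suc n} f≤g = +-mono-≤ (f≤g zero) (sum-mono-≤ (f≤g ∘ suc))

term≤sum : ∀ {n} (f : Fin n → ℕ) x → f x ≤ sum f
term≤sum f zero = m≤m+n _ _
term≤sum f (suc x) = ≤-trans (term≤sum (f ∘ suc) x) (m≤n+m _ (f zero))

positive-term : ∀ {n} (f : Fin n → ℕ) → 1 ≤ sum f → ∃ λ x → 1 ≤ f x
positive-term {suc n} f pos with f zero in eq
... | suc _ = zero , subst (1 ≤_) (sym eq) (s≤s z≤n)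
... | zero  = let x , fx = positive-term (f ∘ suc) pos in suc x , fx

sum-≤-equality : ∀ {n} {f g : Fin n → ℕ} → (∀ x → f x ≤ g x) → sum f ≡ sum g → ∀ x → f x ≡ g x
sum-≤-equality {suc n} {f} {g} f≤g eq zero = ≤-antisym (f≤g zero)
  (+-cancelʳ-≤ _ _ _ (≤-trans (≤-reflexive (sym eq)) (+-monoʳ-≤ (f zero) (sum-mono-≤ (f≤g ∘ suc)))))
sum-≤-equality {suc n} {f} {g} f≤g eq (suc x) = sum-≤-equality (f≤g ∘ suc)
  (≤-antisym (sum-mono-≤ (f≤g ∘ suc))
    (+-cancelˡ-≤ (g zero) _ _ (≤-trans (≤-reflexive (sym eq)) (+-monoˡ-≤ _ (f≤g zero))))) x

bit≤1 : ∀ b → bit b ≤ 1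
bit≤1 true = s≤s z≤n
bit≤1 false = z≤n

bit-∧ : ∀ a b → bit (a ∧ b) ≡ bit a * bit b
bit-∧ true b = sym (+-identityʳ (bit b))
bit-∧ false b = refl

_==_ : ∀ {n} → Fin n → Fin n → Bool
x == y = ⌊ x ≟ y ⌋

==-refl : ∀ {n} (x : Fin n) → (x == x) ≡ true
==-refl x with x ≟ x
... | yes _ = refl
... | no x≢x = ⊥-elim (x≢x refl)

==-≢ : ∀ {n} {x y : Fin n} → x ≢ y → (x == y) ≡ false
==-≢ {x = x} {y} x≢y with x ≟ y
... | yes x≡y = ⊥-elim (x≢y x≡y)
... | no _ = refl

==-true : ∀ {n} {x y : Fin n} → (x == y) ≡ true → x ≡ y
==-true {x = x} {y} _ with x ≟ y
... | yes x≡y = x≡y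

==-false : ∀ {n} {x y : Fin n} → (x == y) ≡ false → x ≢ y
==-false {x = x} x≠y refl with trans (sym x≠y) (==-refl x)
... | ()

==-suc : ∀ {n} (x y : Fin n) → (suc x == suc y) ≡ (x == y)
==-suc x y with x ≟ y
... | yes _ = refl
... | no _ = refl

sum-δ : ∀ {n} (x₀ : Fin n) (g : Fin n → ℕ) → ∑[ x < n ] (bit (x == x₀) * g x) ≡ g x₀
sum-δ {suc n} zero g = trans (cong₂ _+_ (+-identityʳ (g zero)) (sum-zero {n} λ _ → refl)) (+-identityʳ _)
sum-δ {suc n} (suc x₀) g =
  trans (sum-cong-≗ λ x → cong (λ b → bit b * g (suc x)) (==-suc x x₀)) (sum-δ x₀ (g ∘ suc))

-- Vertex lists are handled through occurrence counts: membership is occ ≥ 1 and distinctness occ ≤ 1,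
-- so that a rearranged path keeps its length and distinctness by counting (length-resp-occ).
module _ {N : ℕ} where

  occ : Fin N → List (Fin N) → ℕ
  occ v [] = 0
  occ v (x ∷ xs) = bit (v == x) + occ v xs

  infix 4 _∈ᴸ_
  _∈ᴸ_ : Fin N → List (Fin N) → Set
  v ∈ᴸ xs = 1 ≤ occ v xs

  record Distinct (xs : List (Fin N)) : Set where
    constructor distinct
    field occ≤1 : ∀ v → occ v xs ≤ 1
  open Distinct public

  occ-++ : ∀ v xs ys → occ v (xs ++ ys) ≡ occ v xs + occ v ys
  occ-++ v [] ys = refl
  occ-++ v (x ∷ xs) ys = trans (cong (bit (v == x) +_) (occ-++ v xs ys)) (sym (+-assoc (bit (v == x)) _ _))

  occ-reverse : ∀ v xs → occ v (reverse xs) ≡ occ v xs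
  occ-reverse v [] = refl
  occ-reverse v (x ∷ xs) = begin
    occ v (reverse (x ∷ xs))               ≡⟨ cong (occ v) (List.unfold-reverse x xs) ⟩
    occ v (reverse xs ∷ʳ x)                ≡⟨ occ-++ v (reverse xs) [ x ] ⟩
    occ v (reverse xs) + (bit (v == x) + 0) ≡⟨ cong₂ _+_ (occ-reverse v xs) (+-identityʳ _) ⟩
    occ v xs + bit (v == x)                 ≡⟨ +-comm (occ v xs) _ ⟩
    bit (v == x) + occ v xs                 ∎
    where open ≡-Reasoning

  occ-∷-self : ∀ x xs → occ x (x ∷ xs) ≡ suc (occ x xs)
  occ-∷-self x xs = cong (λ b → bit b + occ x xs) (==-refl x)

  ∈-head : ∀ x xs → x ∈ᴸ x ∷ xs
  ∈-head x xs = subst (1 ≤_) (sym (occ-∷-self x xs)) (s≤s z≤n)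

  ∈-tail : ∀ x {y} xs → y ∈ᴸ xs → y ∈ᴸ x ∷ xs
  ∈-tail x xs y∈ = ≤-trans y∈ (m≤n+m _ _)

  ∈-∷⁻ : ∀ {w x xs} → w ∈ᴸ x ∷ xs → w ≡ x ⊎ w ∈ᴸ xs
  ∈-∷⁻ {w} {x} w∈ with w == x in eq
  ... | true = inj₁ (==-true eq)
  ... | false = inj₂ w∈

  ∈-[-]⁻ : ∀ {w x} → w ∈ᴸ [ x ] → w ≡ x
  ∈-[-]⁻ {w} {x} w∈ with ∈-∷⁻ {w} {x} {[]} w∈
  ... | inj₁ w≡x = w≡x
  ... | inj₂ ()

  ∈-++⁺ˡ : ∀ xs ys {v} → v ∈ᴸ xs → v ∈ᴸ xs ++ ys
  ∈-++⁺ˡ xs ys {v} v∈ = subst (1 ≤_) (sym (occ-++ v xs ys)) (≤-trans v∈ (m≤m+n _ _))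

  ∈-++⁺ʳ : ∀ xs ys {v} → v ∈ᴸ ys → v ∈ᴸ xs ++ ys
  ∈-++⁺ʳ xs ys {v} v∈ = subst (1 ≤_) (sym (occ-++ v xs ys)) (≤-trans v∈ (m≤n+m _ _))

  ∈-++⁻ : ∀ xs ys {v} → v ∈ᴸ xs ++ ys → v ∈ᴸ xs ⊎ v ∈ᴸ ys
  ∈-++⁻ xs ys {v} v∈ with occ v xs in eq
  ... | suc _ = inj₁ (s≤s z≤n)
  ... | zero = inj₂ (subst (1 ≤_) (trans (occ-++ v xs ys) (cong (_+ occ v ys) eq)) v∈)

  ∉⇒occ≡0 : ∀ v xs → ¬ v ∈ᴸ xs → occ v xs ≡ 0
  ∉⇒occ≡0 v xs v∉ with occ v xs
  ... | zero = refl
  ... | suc _ = ⊥-elim (v∉ (s≤s z≤n))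

  _∈ᴸ?_ : (v : Fin N) (xs : List (Fin N)) → Dec (v ∈ᴸ xs)
  v ∈ᴸ? xs = 1 ≤? occ v xs

  bit-∈ᴸ? : ∀ {xs} → Distinct xs → ∀ v → bit ⌊ v ∈ᴸ? xs ⌋ ≡ occ v xs
  bit-∈ᴸ? {xs} d v = bit-positive (occ v xs) (occ≤1 d v)
    where
    bit-positive : ∀ n → n ≤ 1 → bit ⌊ 1 ≤? n ⌋ ≡ n
    bit-positive zero _ = refl
    bit-positive (suc zero) _ = refl
    bit-positive (suc (suc n)) (s≤s ())

  ∈ᴸ?-sound : ∀ {v xs} → ⌊ v ∈ᴸ? xs ⌋ ≡ true → v ∈ᴸ xs
  ∈ᴸ?-sound {v} {xs} _ with v ∈ᴸ? xs
  ... | yes v∈ = v∈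

  ∈ᴸ?-complete : ∀ {v xs} → v ∈ᴸ xs → ⌊ v ∈ᴸ? xs ⌋ ≡ true
  ∈ᴸ?-complete {v} {xs} v∈ with v ∈ᴸ? xs
  ... | yes _ = refl
  ... | no v∉ = contradiction v∈ v∉

  ∈-split : ∀ {v} xs → v ∈ᴸ xs → ∃ λ ys → ∃ λ zs → xs ≡ ys ++ v ∷ zs
  ∈-split {v} (x ∷ xs) v∈ with ∈-∷⁻ {v} {x} {xs} v∈
  ... | inj₁ refl = [] , xs , refl
  ... | inj₂ v∈xs = let ys , zs , eq = ∈-split xs v∈xs in x ∷ ys , zs , cong (x ∷_) eq

  sum-occ-weighted : ∀ xs (g : Fin N → ℕ) → ∑[ v < N ] (occ v xs * g v) ≡ sumˡ (map g xs)
  sum-occ-weighted [] g = sum-zero {N} λ _ → refl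
  sum-occ-weighted (x ∷ xs) g =
    trans (sum-cong-≗ {N} λ v → *-distribʳ-+ (g v) (bit (v == x)) (occ v xs))
      (trans (∑-distrib-+ {N} _ _) (cong₂ _+_ (sum-δ x g) (sum-occ-weighted xs g)))

  sum-occ : ∀ xs → ∑[ v < N ] occ v xs ≡ length xs
  sum-occ xs = trans (sum-cong-≗ {N} λ v → sym (*-identityʳ (occ v xs)))
    (trans (sum-occ-weighted xs (λ _ → 1)) (sum-ones xs))
    where
    sum-ones : ∀ xs → sumˡ (map (λ _ → 1) xs) ≡ length xs
    sum-ones [] = refl
    sum-ones (_ ∷ xs) = cong suc (sum-ones xs)

  length-resp-occ : ∀ {xs ys} → (∀ v → occ v ys ≡ occ v xs) → length ys ≡ length xs
  length-resp-occ {xs} {ys} same = trans (sym (sum-occ ys)) (trans (sum-cong-≗ {N} same) (sum-occ xs))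

  Distinct-resp-occ : ∀ {xs ys} → (∀ v → occ v ys ≡ occ v xs) → Distinct xs → Distinct ys
  Distinct-resp-occ same d = distinct λ v → subst (_≤ 1) (sym (same v)) (occ≤1 d v)

  Distinct-[-] : ∀ x → Distinct [ x ]
  Distinct-[-] x = distinct λ v → subst (_≤ 1) (sym (+-identityʳ _)) (bit≤1 (v == x))

  Distinct-∷ : ∀ {x xs} → occ x xs ≡ 0 → Distinct xs → Distinct (x ∷ xs)
  Distinct-∷ {x} {xs} fresh d = distinct occ≤1′
    where
    occ≤1′ : ∀ v → occ v (x ∷ xs) ≤ 1
    occ≤1′ v with v == x in eq
    ... | false = occ≤1 d v
    ... | true rewrite ==-true eq | fresh = s≤s z≤n

  Distinct-tail : ∀ {x xs} → Distinct (x ∷ xs) → Distinct xs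
  Distinct-tail {x} {xs} d = distinct λ v → ≤-trans (m≤n+m (occ v xs) (bit (v == x))) (occ≤1 d v)

  Distinct-fresh : ∀ {x xs} → Distinct (x ∷ xs) → occ x xs ≡ 0
  Distinct-fresh {x} {xs} d = n≤0⇒n≡0 (≤-pred (subst (_≤ 1) (occ-∷-self x xs) (occ≤1 d x)))

  Distinct-++⁻ˡ : ∀ xs {ys} → Distinct (xs ++ ys) → Distinct xs
  Distinct-++⁻ˡ xs {ys} d = distinct λ v → ≤-trans (m≤m+n (occ v xs) (occ v ys)) (subst (_≤ 1) (occ-++ v xs ys) (occ≤1 d v))

  Distinct-++⁻ʳ : ∀ xs {ys} → Distinct (xs ++ ys) → Distinct ys
  Distinct-++⁻ʳ xs {ys} d = distinct λ v → ≤-trans (m≤n+m (occ v ys) (occ v xs)) (subst (_≤ 1) (occ-++ v xs ys) (occ≤1 d v))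

  Distinct-++ : ∀ {xs ys} → Distinct xs → Distinct ys → (∀ v → v ∈ᴸ xs → occ v ys ≡ 0) → Distinct (xs ++ ys)
  Distinct-++ {xs} {ys} dx dy disjoint = distinct occ≤1′
    where
    occ≤1′ : ∀ v → occ v (xs ++ ys) ≤ 1
    occ≤1′ v with occ v xs in eq
    ... | zero = subst (_≤ 1) (sym (trans (occ-++ v xs ys) (cong (_+ occ v ys) eq))) (occ≤1 dy v)
    ... | suc m = subst (_≤ 1) (sym (trans (occ-++ v xs ys) (cong₂ _+_ eq (disjoint v (subst (1 ≤_) (sym eq) (s≤s z≤n))))))
                    (subst (_≤ 1) (trans eq (sym (+-identityʳ (suc m)))) (occ≤1 dx v))

  Distinct-reverse : ∀ {xs} → Distinct xs → Distinct (reverse xs)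
  Distinct-reverse {xs} = Distinct-resp-occ (λ v → occ-reverse v xs)

  Distinct⇒≢ : ∀ {x y ys} → Distinct (x ∷ y ∷ ys) → x ≢ y
  Distinct⇒≢ {x} {y} {ys} d refl = 1+n≰n (≤-trans (s≤s (∈-head x ys)) (subst (_≤ 1) (occ-∷-self x (x ∷ ys)) (occ≤1 d x)))

  Head : List (Fin N) → Fin N → Set
  Head xs b = ∃ λ bs → xs ≡ b ∷ bs

  Head-unique : ∀ {xs b b′} → Head xs b → Head xs b′ → b ≡ b′
  Head-unique (_ , refl) (_ , refl) = refl

  Head-++ : ∀ {xs b} ys → Head xs b → Head (xs ++ ys) b
  Head-++ ys (bs , refl) = bs ++ ys , refl

  Head⇒nonempty : ∀ {xs b} → Head xs b → 1 ≤ length xs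
  Head⇒nonempty (_ , refl) = s≤s z≤n

  data Last : List (Fin N) → Fin N → Set where
    last-[-] : ∀ {a} → Last [ a ] a
    last-∷ : ∀ {x xs a} → Last xs a → Last (x ∷ xs) a

  last-exists : ∀ x xs → ∃ λ a → Last (x ∷ xs) a
  last-exists x [] = x , last-[-]
  last-exists x (y ∷ ys) = let a , l = last-exists y ys in a , last-∷ l

  Last-unique : ∀ {xs a b} → Last xs a → Last xs b → a ≡ b
  Last-unique last-[-] last-[-] = refl
  Last-unique (last-∷ l) (last-∷ l′) = Last-unique l l′

  Last-++ : ∀ xs {ys a} → Last ys a → Last (xs ++ ys) a
  Last-++ [] l = l
  Last-++ (x ∷ xs) l = last-∷ (Last-++ xs l)

  Last-∷ʳ : ∀ xs a → Last (xs ∷ʳ a) a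
  Last-∷ʳ xs a = Last-++ xs last-[-]

  Last-++⁻ : ∀ xs {y ys a} → Last (xs ++ y ∷ ys) a → Last (y ∷ ys) a
  Last-++⁻ [] l = l
  Last-++⁻ (x ∷ []) (last-∷ l) = l
  Last-++⁻ (x ∷ x′ ∷ xs) (last-∷ l) = Last-++⁻ (x′ ∷ xs) l

  Last⇒∷ʳ : ∀ {xs a} → Last xs a → ∃ λ ys → xs ≡ ys ∷ʳ a
  Last⇒∷ʳ last-[-] = [] , refl
  Last⇒∷ʳ (last-∷ {x} l) = let ys , eq = Last⇒∷ʳ l in x ∷ ys , cong (x ∷_) eq

  Head⇒Last-reverse : ∀ {xs b} → Head xs b → Last (reverse xs) b
  Head⇒Last-reverse {b = b} (bs , refl) = subst (λ l → Last l b) (sym (List.unfold-reverse b bs)) (Last-∷ʳ (reverse bs) b)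

  Last⇒Head-reverse : ∀ {xs a} → Last xs a → Head (reverse xs) a
  Last⇒Head-reverse {a = a} l with Last⇒∷ʳ l
  ... | ys , refl = reverse ys , List.reverse-++ ys [ a ]

  Last⇒∈ : ∀ {xs a} → Last xs a → a ∈ᴸ xs
  Last⇒∈ (last-[-] {a}) = ∈-head a []
  Last⇒∈ (last-∷ {x} {xs} l) = ∈-tail x xs (Last⇒∈ l)

  module _ {R : Fin N → Fin N → Set} where

    Linked-++ : ∀ {xs ys} → Linked R xs → Linked R ys → (∀ {a b} → Last xs a → Head ys b → R a b) → Linked R (xs ++ ys)
    Linked-++ [] rys _ = rys
    Linked-++ {ys = []} [-] _ _ = [-]
    Linked-++ {ys = y ∷ ys} [-] rys junction = junction last-[-] (ys , refl) ∷ rys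
    Linked-++ (r ∷ rxs) rys junction = r ∷ Linked-++ rxs rys (junction ∘ last-∷)

    Linked-∷ : ∀ {x y ys} → R x y → Head ys y → Linked R ys → Linked R (x ∷ ys)
    Linked-∷ r (_ , refl) rs = r ∷ rs

    Linked-∷ʳ : ∀ {xs a b} → Linked R xs → Last xs a → R a b → Linked R (xs ∷ʳ b)
    Linked-∷ʳ rs l r = Linked-++ rs [-] λ l′ → λ { (_ , refl) → subst (λ a → R a _) (Last-unique l l′) r }

    Linked-++⁻ˡ : ∀ xs {ys} → Linked R (xs ++ ys) → Linked R xs
    Linked-++⁻ˡ [] rs = []
    Linked-++⁻ˡ (x ∷ []) rs = [-]
    Linked-++⁻ˡ (x ∷ y ∷ xs) (r ∷ rs) = r ∷ Linked-++⁻ˡ (y ∷ xs) rs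

    Linked-++⁻ʳ : ∀ xs {ys} → Linked R (xs ++ ys) → Linked R ys
    Linked-++⁻ʳ [] rs = rs
    Linked-++⁻ʳ (x ∷ xs) rs = Linked-++⁻ʳ xs (Linked-tail rs)

    Linked-junction : ∀ xs {y ys a} → Linked R (xs ++ y ∷ ys) → Last xs a → R a y
    Linked-junction (x ∷ []) (r ∷ _) last-[-] = r
    Linked-junction (x ∷ x′ ∷ xs) (_ ∷ rs) (last-∷ l) = Linked-junction (x′ ∷ xs) rs l

    Linked-reverse : (∀ {a b} → R a b → R b a) → ∀ {xs} → Linked R xs → Linked R (reverse xs)
    Linked-reverse R-sym [] = []
    Linked-reverse R-sym [-] = [-]
    Linked-reverse R-sym {x ∷ y ∷ ys} (r ∷ rs) = subst (Linked R) (sym (List.unfold-reverse x (y ∷ ys)))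
      (Linked-∷ʳ (Linked-reverse R-sym rs) (Head⇒Last-reverse (ys , refl)) (R-sym r))

    Linked-lookup : ∀ xs → Linked R xs → ∀ i j → toℕ j ≡ suc (toℕ i) → R (lookup xs i) (lookup xs j)
    Linked-lookup (x ∷ y ∷ ys) (r ∷ rs) zero (suc zero) _ = r
    Linked-lookup (x ∷ y ∷ ys) (r ∷ rs) (suc i) (suc j) eq = Linked-lookup (y ∷ ys) rs i j (suc-injective eq)

  fresh⇒∉ : ∀ x xs → occ x xs ≡ 0 → ¬ x ∈ᴸ xs
  fresh⇒∉ x xs fresh x∈ = 1+n≰n (subst (1 ≤_) fresh x∈)

  lookup-∈ : ∀ xs i → lookup xs i ∈ᴸ xs
  lookup-∈ (x ∷ xs) zero = ∈-head x xs
  lookup-∈ (x ∷ xs) (suc i) = ∈-tail x xs (lookup-∈ xs i)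

  lookup-injective : ∀ xs → Distinct xs → ∀ i j → lookup xs i ≡ lookup xs j → i ≡ j
  lookup-injective (x ∷ xs) d zero zero _ = refl
  lookup-injective (x ∷ xs) d zero (suc j) eq =
    contradiction (subst (_∈ᴸ xs) (sym eq) (lookup-∈ xs j)) (fresh⇒∉ x xs (Distinct-fresh d))
  lookup-injective (x ∷ xs) d (suc i) zero eq =
    contradiction (subst (_∈ᴸ xs) eq (lookup-∈ xs i)) (fresh⇒∉ x xs (Distinct-fresh d))
  lookup-injective (x ∷ xs) d (suc i) (suc j) eq = cong suc (lookup-injective xs (Distinct-tail d) i j eq)

module _ {m n : ℕ} (g : Fin m → Fin n) where

  ∈-map⁻ : ∀ {v} xs → v ∈ᴸ map g xs → ∃ λ x → g x ≡ v × x ∈ᴸ xs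
  ∈-map⁻ {v} (x ∷ xs) v∈ with ∈-∷⁻ {xs = map g xs} v∈
  ... | inj₁ v≡gx = x , sym v≡gx , ∈-head x xs
  ... | inj₂ v∈′ = let y , gy≡v , y∈ = ∈-map⁻ xs v∈′ in y , gy≡v , ∈-tail x xs y∈

  Distinct-map : (∀ x y → g x ≡ g y → x ≡ y) → ∀ {xs} → Distinct xs → Distinct (map g xs)
  Distinct-map g-inj {[]} d = distinct λ _ → z≤n
  Distinct-map g-inj {x ∷ xs} d = Distinct-∷ (∉⇒occ≡0 (g x) (map g xs) gx∉) (Distinct-map g-inj (Distinct-tail d))
    where
    gx∉ : ¬ g x ∈ᴸ map g xs
    gx∉ gx∈ = let y , gy≡gx , y∈ = ∈-map⁻ xs gx∈ in
      fresh⇒∉ x xs (Distinct-fresh d) (subst (_∈ᴸ xs) (g-inj y x gy≡gx) y∈)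

  Head-map : ∀ {xs a} → Head xs a → Head (map g xs) (g a)
  Head-map (bs , refl) = map g bs , refl

  Last-map : ∀ {xs a} → Last xs a → Last (map g xs) (g a)
  Last-map last-[-] = last-[-]
  Last-map (last-∷ l) = last-∷ (Last-map l)

select : ∀ {n} → (Fin n → Bool) → List (Fin n)
select {zero} f = []
select {suc n} f = if f zero then zero ∷ rest else rest
  where rest = map suc (select (f ∘ suc))

occ-zero-map : ∀ {n} (xs : List (Fin n)) → occ zero (map suc xs) ≡ 0
occ-zero-map [] = refl
occ-zero-map (x ∷ xs) = occ-zero-map xs

occ-suc-map : ∀ {n} (w : Fin n) xs → occ (suc w) (map suc xs) ≡ occ w xs
occ-suc-map w [] = refl
occ-suc-map w (x ∷ xs) = cong₂ _+_ (cong bit (==-suc w x)) (occ-suc-map w xs)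

occ-select : ∀ {n} (f : Fin n → Bool) w → occ w (select f) ≡ bit (f w)
occ-select {suc n} f zero with f zero
... | true = cong suc (occ-zero-map (select (f ∘ suc)))
... | false = occ-zero-map (select (f ∘ suc))
occ-select {suc n} f (suc w) with f zero
... | true = trans (occ-suc-map w (select (f ∘ suc))) (occ-select (f ∘ suc) w)
... | false = trans (occ-suc-map w (select (f ∘ suc))) (occ-select (f ∘ suc) w)

length-select : ∀ {n} (f : Fin n → Bool) → length (select f) ≡ ∑[ w < n ] bit (f w)
length-select {n} f = trans (sym (sum-occ (select f))) (sum-cong-≗ {n} (occ-select f))

Distinct-select : ∀ {n} (f : Fin n → Bool) → Distinct (select f)
Distinct-select f = distinct λ v → subst (_≤ 1) (sym (occ-select f v)) (bit≤1 (f v))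

∈-select⁻ : ∀ {n} (f : Fin n → Bool) {w} → w ∈ᴸ select f → f w ≡ true
∈-select⁻ f {w} w∈ with f w | occ-select f w
... | true | _ = refl
... | false | eq = contradiction (subst (1 ≤_) eq w∈) λ ()

module PathsIn {N : ℕ} (Q : Graph N) where

  Adj : Fin N → Fin N → Set
  Adj u v = adj Q u v ≡ true

  Adj-sym : ∀ {u v} → Adj u v → Adj v u
  Adj-sym {u} {v} e = trans (symm Q v u) e

  record PathIn (X : Fin N → Bool) (xs : List (Fin N)) : Set where
    constructor path
    field
      path-distinct : Distinct xs
      path-linked : Linked Adj xs
      path-inside : ∀ v → v ∈ᴸ xs → X v ≡ true
  open PathIn public

  Path : List (Fin N) → Set
  Path = PathIn (λ _ → true)

  PathFreeOn : (Fin N → Bool) → ℕ → Set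
  PathFreeOn X m = ∀ xs → PathIn X xs → m ≤ length xs → ⊥

  LongerPath : (Fin N → Bool) → List (Fin N) → Set
  LongerPath X xs = ∃ λ ys → PathIn X ys × length xs < length ys

  deg : (Fin N → Bool) → Fin N → ℕ
  deg X v = ∑[ u < N ] (bit (X u) * bit (adj Q v u))

  degSum : (Fin N → Bool) → ℕ
  degSum X = ∑[ v < N ] (bit (X v) * deg X v)

  card : (Fin N → Bool) → ℕ
  card X = ∑[ v < N ] bit (X v)

  inside-∷ : ∀ {X : Fin N → Bool} {u : Fin N} {xs : List (Fin N)} → X u ≡ true → (∀ v → v ∈ᴸ xs → X v ≡ true) → ∀ v → v ∈ᴸ u ∷ xs → X v ≡ true
  inside-∷ {X} {u} {xs} Xu inside v v∈ with ∈-∷⁻ {w = v} {x = u} {xs = xs} v∈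
  ... | inj₁ refl = Xu
  ... | inj₂ v∈xs = inside v v∈xs

  PathIn-reverse : ∀ {X xs} → PathIn X xs → PathIn X (reverse xs)
  PathIn-reverse {X} {xs} (path d l inside) =
    path (Distinct-reverse d) (Linked-reverse Adj-sym l) (λ v v∈ → inside v (subst (1 ≤_) (occ-reverse v xs) v∈))

  LongerPath-reverse : ∀ {X xs} → LongerPath X (reverse xs) → LongerPath X xs
  LongerPath-reverse {X} {xs} (ys , p , lt) = ys , p , subst (_< length ys) (List.length-reverse xs) lt

  longer-by-occ : ∀ {X u xs} ys → Linked Adj ys → (∀ v → occ v ys ≡ occ v (u ∷ xs)) →
    Distinct (u ∷ xs) → (∀ v → v ∈ᴸ u ∷ xs → X v ≡ true) → LongerPath X xs
  longer-by-occ {X} {u} {xs} ys l same d inside =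
    ys , path (Distinct-resp-occ same d) l (λ v v∈ → inside v (subst (1 ≤_) (same v) v∈)) ,
    ≤-reflexive (sym (length-resp-occ {xs = u ∷ xs} {ys} same))

  linked-clique : ∀ xs → Distinct xs → (∀ {x y} → x ∈ᴸ xs → y ∈ᴸ xs → x ≢ y → Adj x y) → Linked Adj xs
  linked-clique [] _ _ = []
  linked-clique (x ∷ []) _ _ = [-]
  linked-clique (x ∷ y ∷ ys) d clique =
    clique (∈-head x (y ∷ ys)) (∈-tail x (y ∷ ys) (∈-head y ys)) (Distinct⇒≢ d) ∷
    linked-clique (y ∷ ys) (Distinct-tail d) λ a∈ b∈ → clique (∈-tail x (y ∷ ys) a∈) (∈-tail x (y ∷ ys) b∈)

  complete-path : (∀ {u v} → u ≢ v → Adj u v) → ∀ a → ∃ λ P → Path P × Last P a × length P ≡ N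
  complete-path complete a = P , path distinct′ (linked-clique P distinct′ λ _ _ → complete) (λ _ _ → refl) ,
    Last-∷ʳ others a , trans (sym (sum-occ P)) (trans (sum-cong-≗ {N} once) (trans (sum-const N 1) (*-identityʳ N)))
    where
    others = select λ b → not (b == a)
    P = others ∷ʳ a
    once : ∀ v → occ v P ≡ 1
    once v = trans (occ-++ v others [ a ]) (trans (cong (_+ occ v [ a ]) (occ-select _ v)) (split (v == a)))
      where
      split : ∀ b → bit (not b) + (bit b + 0) ≡ 1
      split true = refl
      split false = refl
    distinct′ : Distinct P
    distinct′ = distinct λ v → ≤-reflexive (once v)

  path⇒ContainsPath : ∀ {ℓ xs} → Path xs → ℓ ≤ length xs → ContainsPath Q ℓ
  path⇒ContainsPath {ℓ} {xs} (path d l _) ℓ≤ = f , f-injective , f-adjacent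
    where
    f : Fin ℓ → Fin N
    f i = lookup xs (inject≤ i ℓ≤)
    f-injective : ∀ i j → f i ≡ f j → i ≡ j
    f-injective i j eq = toℕ-injective (trans (sym (toℕ-inject≤ i ℓ≤))
      (trans (cong toℕ (lookup-injective xs d _ _ eq)) (toℕ-inject≤ j ℓ≤)))
    f-adjacent : ∀ i j → toℕ j ≡ suc (toℕ i) → adj Q (f i) (f j) ≡ true
    f-adjacent i j j≡1+i = Linked-lookup xs l (inject≤ i ℓ≤) (inject≤ j ℓ≤)
      (trans (toℕ-inject≤ j ℓ≤) (trans j≡1+i (cong suc (sym (toℕ-inject≤ i ℓ≤)))))

  Saturated : (Fin N → Bool) → Fin N → List (Fin N) → Set
  Saturated X x L = ∀ u → X u ≡ true → Adj u x → u ∈ᴸ L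

  extend-or-saturated : ∀ {X} x xs → PathIn X (x ∷ xs) → LongerPath X (x ∷ xs) ⊎ Saturated X x (x ∷ xs)
  extend-or-saturated {X} x xs (path d l inside)
    with any? {P = λ u → X u ≡ true × Adj u x × ¬ u ∈ᴸ x ∷ xs} (λ u → (X u ≟ᵇ true) ×-dec (adj Q u x ≟ᵇ true) ×-dec ¬? (u ∈ᴸ? (x ∷ xs)))
  ... | yes (u , Xu , u~x , u∉) =
    inj₁ (u ∷ x ∷ xs , path (Distinct-∷ (∉⇒occ≡0 u (x ∷ xs) u∉) d) (u~x ∷ l) (inside-∷ {xs = x ∷ xs} Xu inside) , ≤-refl)
  ... | no none = inj₂ λ u Xu u~x → decidable-stable (u ∈ᴸ? (x ∷ xs)) λ u∉ → none (u , Xu , u~x , u∉)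

  adjacent-count : Fin N → List (Fin N) → ℕ
  adjacent-count x L = sumˡ (map (λ c → bit (adj Q x c)) L)

  deg≤adjacent-count : ∀ {X} x L → Saturated X x L → deg X x ≤ adjacent-count x L
  deg≤adjacent-count {X} x L sat = ≤-trans (sum-mono-≤ termwise) (≤-reflexive (sum-occ-weighted L _))
    where
    termwise : ∀ u → bit (X u) * bit (adj Q x u) ≤ occ u L * bit (adj Q x u)
    termwise u with X u in Xu | adj Q x u in x~u
    ... | false | _ = z≤n
    ... | true | false = z≤n
    ... | true | true = subst (1 ≤_) (sym (*-identityʳ _)) (sat u Xu (Adj-sym x~u))

  -- Consecutive pairs (y, c) of L with y ~ z and c ~ x: each one closes L into a cycle.
  crossings : Fin N → Fin N → List (Fin N) → ℕ
  crossings x z (y ∷ c ∷ r) = bit (adj Q x c) + bit (adj Q z y) + crossings x z (c ∷ r)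
  crossings x z _ = 0

  adjacent-counts≡crossings : ∀ x z h t {l} → Last (h ∷ t) l →
    adjacent-count x (h ∷ t) + adjacent-count z (h ∷ t) ≡ bit (adj Q x h) + bit (adj Q z l) + crossings x z (h ∷ t)
  adjacent-counts≡crossings x z h [] last-[-] = regroup (bit (adj Q x h)) (bit (adj Q z h))
    where
    regroup : ∀ a b → a + 0 + (b + 0) ≡ a + b + 0
    regroup = solve-∀
  adjacent-counts≡crossings x z h (c ∷ r) {l} (last-∷ lst) =
    trans (regroup (bit (adj Q x h)) (bit (adj Q z h)) _ _)
      (trans (cong (bit (adj Q x h) + bit (adj Q z h) +_) (adjacent-counts≡crossings x z c r lst))
        (reorder (bit (adj Q x h)) (bit (adj Q z h)) (bit (adj Q x c)) (bit (adj Q z l)) (crossings x z (c ∷ r))))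
    where
    regroup : ∀ a b s t → a + s + (b + t) ≡ a + b + (s + t)
    regroup = solve-∀
    reorder : ∀ a b c d r → a + b + (c + d + r) ≡ a + d + (c + b + r)
    reorder = solve-∀

  record PosaSplit (x z : Fin N) (L : List (Fin N)) : Set where
    constructor posaSplit
    field
      front back : List (Fin N)
      split : L ≡ front ++ back
      {front-last} : Fin N
      front-ends : Last front front-last
      z~front-last : Adj z front-last
      {back-head} : Fin N
      back-starts : Head back back-head
      x~back-head : Adj x back-head

  PosaSplit-∷ : ∀ {x z c r} y → PosaSplit x z (c ∷ r) → PosaSplit x z (y ∷ c ∷ r)
  PosaSplit-∷ y (posaSplit f b eq fl zf bh xb) = posaSplit (y ∷ f) b (cong (y ∷_) eq) (last-∷ fl) zf bh xb

  posa-split : ∀ x z y ys → length (y ∷ ys) ≤ crossings x z (y ∷ ys) → PosaSplit x z (y ∷ ys)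
  posa-split x z y (c ∷ r) bound with adj Q x c in x~c | adj Q z y in z~y
  ... | true | true = posaSplit [ y ] (c ∷ r) refl last-[-] z~y (r , refl) x~c
  ... | true | false = PosaSplit-∷ y (posa-split x z c r (≤-pred bound))
  ... | false | true = PosaSplit-∷ y (posa-split x z c r (≤-pred bound))
  ... | false | false = PosaSplit-∷ y (posa-split x z c r (≤-trans (n≤1+n _) bound))

  rotation-linked : ∀ {u c} ys₁ ys₂ zs {h yl zh zl} → Linked Adj ((ys₁ ++ c ∷ ys₂) ++ zs) →
    Head (ys₁ ++ c ∷ ys₂) h → Last (ys₁ ++ c ∷ ys₂) yl → Head zs zh → Last zs zl →
    Adj h zh → Adj zl yl → Adj u c → Linked Adj (u ∷ (c ∷ ys₂) ++ reverse zs ++ ys₁)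
  rotation-linked {u} {c} ys₁ ys₂ zs linked h… …yl zh… …zl h~zh zl~yl u~c = u~c ∷ Linked-++ from-c back-to-front junction
    where
    ys = ys₁ ++ c ∷ ys₂
    linked-ys = Linked-++⁻ˡ ys linked
    from-c : Linked Adj (c ∷ ys₂)
    from-c = Linked-++⁻ʳ ys₁ linked-ys
    back-to-front : Linked Adj (reverse zs ++ ys₁)
    back-to-front = Linked-++ (Linked-reverse Adj-sym (Linked-++⁻ʳ ys linked)) (Linked-++⁻ˡ ys₁ linked-ys)
      λ l h → subst₂ Adj (Last-unique (Head⇒Last-reverse zh…) l) (Head-unique h… (Head-++ (c ∷ ys₂) h)) (Adj-sym h~zh)
    junction : ∀ {a b} → Last (c ∷ ys₂) a → Head (reverse zs ++ ys₁) b → Adj a b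
    junction l h = subst₂ Adj (Last-unique …yl (Last-++ ys₁ l)) (Head-unique (Head-++ ys₁ (Last⇒Head-reverse …zl)) h) (Adj-sym zl~yl)

  rotation-occ : ∀ (u c : Fin N) ys₁ ys₂ zs v →
    occ v (u ∷ (c ∷ ys₂) ++ reverse zs ++ ys₁) ≡ occ v (u ∷ (ys₁ ++ c ∷ ys₂) ++ zs)
  rotation-occ u c ys₁ ys₂ zs v = cong (bit (v == u) +_) (begin
    occ v ((c ∷ ys₂) ++ reverse zs ++ ys₁)             ≡⟨ occ-++ v (c ∷ ys₂) _ ⟩
    occ v (c ∷ ys₂) + occ v (reverse zs ++ ys₁)        ≡⟨ cong (occ v (c ∷ ys₂) +_) (occ-++ v (reverse zs) ys₁) ⟩
    occ v (c ∷ ys₂) + (occ v (reverse zs) + occ v ys₁) ≡⟨ cong (λ n → occ v (c ∷ ys₂) + (n + occ v ys₁)) (occ-reverse v zs) ⟩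
    occ v (c ∷ ys₂) + (occ v zs + occ v ys₁)           ≡⟨ regroup (occ v (c ∷ ys₂)) (occ v zs) (occ v ys₁) ⟩
    occ v ys₁ + occ v (c ∷ ys₂) + occ v zs             ≡⟨ cong (_+ occ v zs) (occ-++ v ys₁ (c ∷ ys₂)) ⟨
    occ v (ys₁ ++ c ∷ ys₂) + occ v zs                  ≡⟨ occ-++ v (ys₁ ++ c ∷ ys₂) zs ⟨
    occ v ((ys₁ ++ c ∷ ys₂) ++ zs)                     ∎)
    where
    open ≡-Reasoning
    regroup : ∀ a b c → a + (b + c) ≡ c + a + b
    regroup = solve-∀

  -- Posa's rotation: if the path ys ++ zs closes into a cycle (h ~ zh and zl ~ yl), an outside
  -- neighbour u of a vertex c of ys can be prepended to the cycle broken just before c.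
  rotate : ∀ {X u c} ys zs {h yl zh zl} → PathIn X (ys ++ zs) →
    Head ys h → Last ys yl → Head zs zh → Last zs zl → Adj h zh → Adj zl yl →
    X u ≡ true → ¬ u ∈ᴸ ys ++ zs → Adj u c → c ∈ᴸ ys → LongerPath X (ys ++ zs)
  rotate {X} {u} {c} ys zs P h… …yl zh… …zl h~zh zl~yl Xu u∉ u~c c∈ with ∈-split ys c∈
  ... | ys₁ , ys₂ , refl =
    longer-by-occ (u ∷ (c ∷ ys₂) ++ reverse zs ++ ys₁)
      (rotation-linked ys₁ ys₂ zs (path-linked P) h… …yl zh… …zl h~zh zl~yl u~c)
      (rotation-occ u c ys₁ ys₂ zs)
      (Distinct-∷ (∉⇒occ≡0 u ((ys₁ ++ c ∷ ys₂) ++ zs) u∉) (path-distinct P)) (inside-∷ {xs = (ys₁ ++ c ∷ ys₂) ++ zs} Xu (path-inside P))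

  Closed : (Fin N → Bool) → List (Fin N) → Set
  Closed X C = ∀ {u c} → X u ≡ true → c ∈ᴸ C → Adj c u → u ∈ᴸ C

  closed-or-exit : ∀ X C → Closed X C ⊎ ∃ λ u → ∃ λ c → X u ≡ true × ¬ u ∈ᴸ C × c ∈ᴸ C × Adj c u
  closed-or-exit X C with any? {P = λ u → X u ≡ true × ¬ u ∈ᴸ C × ∃ λ c → c ∈ᴸ C × Adj c u}
    (λ u → (X u ≟ᵇ true) ×-dec ¬? (u ∈ᴸ? C) ×-dec any? λ c → (c ∈ᴸ? C) ×-dec (adj Q c u ≟ᵇ true))
  ... | yes (u , Xu , u∉ , c , c∈ , c~u) = inj₂ (u , c , Xu , u∉ , c∈ , c~u)
  ... | no none = inj₁ λ {u} {c} Xu c∈ c~u → decidable-stable (u ∈ᴸ? C) λ u∉ → none (u , Xu , u∉ , c , c∈ , c~u)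

  ≤-sum-of-halves : ∀ m a b → m ≤ 2 * a → m ≤ 2 * b → m ≤ a + b
  ≤-sum-of-halves m a b m≤2a m≤2b = *-cancelˡ-≤ 2 (begin
    2 * m     ≡⟨ cong (m +_) (+-identityʳ m) ⟩
    m + m     ≤⟨ +-mono-≤ m≤2a m≤2b ⟩
    2 * a + 2 * b ≡⟨ *-distribˡ-+ 2 a b ⟨
    2 * (a + b) ∎)
    where open ≤-Reasoning

  module Posa (X : Fin N → Bool) (p : ℕ)
              (min-degree : ∀ v → X v ≡ true → suc p ≤ 2 * deg X v)
              (path-free : PathFreeOn X (2 + p)) where

    length-bound : ∀ {xs} → PathIn X xs → length xs ≤ suc p
    length-bound {xs} P with length xs ≤? suc p
    ... | yes short = short
    ... | no long = ⊥-elim (path-free xs P (≰⇒> long))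

    private
      head-of-split : ∀ {x : Fin N} {xs ys zs : List (Fin N)} {yl : Fin N} → x ∷ xs ≡ ys ++ zs → Last ys yl → Head ys x
      head-of-split {ys = y ∷ ys} eq _ = ys , cong (_∷ ys) (sym (List.∷-injectiveˡ eq))

      last-of-split : ∀ (ys zs : List (Fin N)) {z zh : Fin N} → Last (ys ++ zs) z → Head zs zh → Last zs z
      last-of-split ys zs l (_ , refl) = Last-++⁻ ys l

    saturated-ends⇒split : ∀ {x xs z} → PathIn X (x ∷ xs) → Last (x ∷ xs) z →
      Saturated X x (x ∷ xs) → Saturated X z (x ∷ xs) → PosaSplit x z (x ∷ xs)
    saturated-ends⇒split {x} {xs} {z} P x…z sat-x sat-z = posa-split x z x xs (begin
      length (x ∷ xs)          ≤⟨ length-bound P ⟩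
      suc p                    ≤⟨ ≤-sum-of-halves (suc p) (deg X x) (deg X z) (min-degree x (path-inside P x (∈-head x xs)))
                                                                (min-degree z (path-inside P z (Last⇒∈ x…z))) ⟩
      deg X x + deg X z        ≤⟨ +-mono-≤ (deg≤adjacent-count x (x ∷ xs) sat-x) (deg≤adjacent-count z (x ∷ xs) sat-z) ⟩
      adjacent-count x (x ∷ xs) + adjacent-count z (x ∷ xs)
                               ≡⟨ adjacent-counts≡crossings x z x xs x…z ⟩
      bit (adj Q x x) + bit (adj Q z z) + crossings x z (x ∷ xs)
                               ≡⟨ cong₂ (λ a b → bit a + bit b + crossings x z (x ∷ xs)) (irrefl Q x) (irrefl Q z) ⟩
      crossings x z (x ∷ xs)   ∎)
      where open ≤-Reasoning

    rotate-or-closed : ∀ {x xs z} → PathIn X (x ∷ xs) → Last (x ∷ xs) z → PosaSplit x z (x ∷ xs) →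
      LongerPath X (x ∷ xs) ⊎ Closed X (x ∷ xs)
    rotate-or-closed {x} {xs} {z} P x…z (posaSplit ys zs L≡ …yl z~yl zh… x~zh) with closed-or-exit X (x ∷ xs)
    ... | inj₁ closed = inj₂ closed
    ... | inj₂ (u , c , Xu , u∉ , c∈ , c~u) with ∈-++⁻ ys zs (subst (c ∈ᴸ_) L≡ c∈)
    ... | inj₁ c∈ys = inj₁ (subst (LongerPath X) (sym L≡)
            (rotate ys zs (subst (PathIn X) L≡ P) x…ys …yl zh… zs…z x~zh z~yl
              Xu (subst (λ l → ¬ u ∈ᴸ l) L≡ u∉) (Adj-sym c~u) c∈ys))
      where
      x…ys = head-of-split L≡ …yl
      zs…z = last-of-split ys zs (subst (λ l → Last l z) L≡ x…z) zh…
    ... | inj₂ c∈zs = inj₁ (LongerPath-reverse {xs = x ∷ xs} (subst (LongerPath X) (sym rev-L≡)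
            (rotate (reverse zs) (reverse ys) (subst (PathIn X) rev-L≡ (PathIn-reverse P))
              (Last⇒Head-reverse zs…z) (Head⇒Last-reverse zh…) (Last⇒Head-reverse …yl) (Head⇒Last-reverse x…ys)
              z~yl x~zh Xu (λ u∈ → u∉ (subst (1 ≤_) (trans (cong (occ u) (sym rev-L≡)) (occ-reverse u (x ∷ xs))) u∈))
              (Adj-sym c~u) (subst (1 ≤_) (sym (occ-reverse c zs)) c∈zs))))
      where
      x…ys = head-of-split L≡ …yl
      zs…z = last-of-split ys zs (subst (λ l → Last l z) L≡ x…z) zh…
      rev-L≡ : reverse (x ∷ xs) ≡ reverse zs ++ reverse ys
      rev-L≡ = trans (cong reverse L≡) (List.reverse-++ ys zs)

    longer-or-closed : ∀ x xs → PathIn X (x ∷ xs) → LongerPath X (x ∷ xs) ⊎ Closed X (x ∷ xs)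
    longer-or-closed x xs P with extend-or-saturated x xs P
    ... | inj₁ longer = inj₁ longer
    ... | inj₂ sat-x with last-exists x xs
    ... | z , x…z with Last⇒Head-reverse x…z
    ... | rs , rev≡ with extend-or-saturated z rs (subst (PathIn X) rev≡ (PathIn-reverse P))
    ... | inj₁ longer = inj₁ (LongerPath-reverse {xs = x ∷ xs} (subst (LongerPath X) (sym rev≡) longer))
    ... | inj₂ sat-z = rotate-or-closed P x…z (saturated-ends⇒split P x…z sat-x
            λ u Xu u~z → subst (1 ≤_) (trans (cong (occ u) (sym rev≡)) (occ-reverse u (x ∷ xs))) (sat-z u Xu u~z))

    closed-path : ∀ budget x xs → PathIn X (x ∷ xs) → 2 + p ≤ length (x ∷ xs) + budget →
      ∃ λ c → ∃ λ cs → PathIn X (c ∷ cs) × Closed X (c ∷ cs)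
    closed-path zero x xs P long = ⊥-elim (path-free (x ∷ xs) P (subst (2 + p ≤_) (+-identityʳ _) long))
    closed-path (suc budget) x xs P long with longer-or-closed x xs P
    ... | inj₂ closed = x , xs , P , closed
    ... | inj₁ (y ∷ ys , P′ , longer) = closed-path budget y ys P′
      (≤-trans long (≤-trans (≤-reflexive (+-suc (length (x ∷ xs)) budget)) (+-monoˡ-≤ budget longer)))

    closed-path-from : ∀ v → X v ≡ true → ∃ λ c → ∃ λ cs → PathIn X (c ∷ cs) × Closed X (c ∷ cs)
    closed-path-from v Xv = closed-path (2 + p) v [] (path (Distinct-[-] v) [-] inside) (m≤n+m (2 + p) 1)
      where
      inside : ∀ w → w ∈ᴸ [ v ] → X w ≡ true
      inside w w∈ rewrite ∈-[-]⁻ w∈ = Xv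

module ErdősGallaiTheorem {N : ℕ} (Q : Graph N) where
  open PathsIn Q

  record Partition (X Y Z : Fin N → Bool) : Set where
    constructor partition
    field split : ∀ v → bit (X v) ≡ bit (Y v) + bit (Z v)
  open Partition

  cross : (Fin N → Bool) → (Fin N → Bool) → ℕ
  cross Y Z = ∑[ v < N ] (bit (Y v) * deg Z v)

  card-partition : ∀ {X Y Z} → Partition X Y Z → card X ≡ card Y + card Z
  card-partition part = trans (sum-cong-≗ {N} (split part)) (∑-distrib-+ {N} _ _)

  deg-partition : ∀ {X Y Z} → Partition X Y Z → ∀ v → deg X v ≡ deg Y v + deg Z v
  deg-partition {X} {Y} {Z} part v =
    trans (sum-cong-≗ {N} λ u → trans (cong (_* bit (adj Q v u)) (split part u)) (*-distribʳ-+ (bit (adj Q v u)) (bit (Y u)) (bit (Z u))))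
      (∑-distrib-+ {N} _ _)

  cross-sym : ∀ Y Z → cross Y Z ≡ cross Z Y
  cross-sym Y Z = begin
    ∑[ v < N ] (bit (Y v) * ∑[ u < N ] (bit (Z u) * bit (adj Q v u)))   ≡⟨ sum-cong-≗ {N} (λ v → *-distribˡ-sum (bit (Y v)) λ u → bit (Z u) * bit (adj Q v u)) ⟩
    ∑[ v < N ] ∑[ u < N ] (bit (Y v) * (bit (Z u) * bit (adj Q v u)))   ≡⟨ ∑-comm {N} {N} _ ⟩
    ∑[ u < N ] ∑[ v < N ] (bit (Y v) * (bit (Z u) * bit (adj Q v u)))   ≡⟨ sum-cong-≗ {N} (λ u → sum-cong-≗ {N} λ v → swap u v) ⟩
    ∑[ u < N ] ∑[ v < N ] (bit (Z u) * (bit (Y v) * bit (adj Q u v)))   ≡⟨ sum-cong-≗ {N} (λ u → *-distribˡ-sum (bit (Z u)) λ v → bit (Y v) * bit (adj Q u v)) ⟨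
    ∑[ u < N ] (bit (Z u) * ∑[ v < N ] (bit (Y v) * bit (adj Q u v)))   ∎
    where
    open ≡-Reasoning
    swap : ∀ u v → bit (Y v) * (bit (Z u) * bit (adj Q v u)) ≡ bit (Z u) * (bit (Y v) * bit (adj Q u v))
    swap u v = trans (cong (λ b → bit (Y v) * (bit (Z u) * bit b)) (symm Q v u)) (*-left-comm (bit (Y v)) (bit (Z u)) _)

  degSum-partition : ∀ {X Y Z} → Partition X Y Z → degSum X ≡ degSum Y + degSum Z + 2 * cross Y Z
  degSum-partition {X} {Y} {Z} part = begin
    ∑[ v < N ] (bit (X v) * deg X v)
      ≡⟨ sum-cong-≗ {N} (λ v → trans (cong₂ _*_ (split part v) (deg-partition part v)) (expand (bit (Y v)) (bit (Z v)) (deg Y v) (deg Z v))) ⟩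
    ∑[ v < N ] ((bit (Y v) * deg Y v + bit (Z v) * deg Z v) + (bit (Y v) * deg Z v + bit (Z v) * deg Y v))
      ≡⟨ ∑-distrib-+ {N} _ _ ⟩
    _ ≡⟨ cong₂ _+_ (∑-distrib-+ {N} _ _) (∑-distrib-+ {N} _ _) ⟩
    degSum Y + degSum Z + (cross Y Z + cross Z Y)
      ≡⟨ cong (λ c → degSum Y + degSum Z + (cross Y Z + c)) (cross-sym Z Y) ⟩
    degSum Y + degSum Z + (cross Y Z + cross Y Z)
      ≡⟨ cong (λ c → degSum Y + degSum Z + (cross Y Z + c)) (+-identityʳ (cross Y Z)) ⟨
    degSum Y + degSum Z + 2 * cross Y Z ∎
    where
    open ≡-Reasoning
    expand : ∀ a b c d → (a + b) * (c + d) ≡ (a * c + b * d) + (a * d + b * c)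
    expand = solve-∀

  _⊆ᵛ_ : (Fin N → Bool) → (Fin N → Bool) → Set
  X ⊆ᵛ Y = ∀ v → X v ≡ true → Y v ≡ true

  PathFreeOn-⊆ : ∀ {X Y m} → X ⊆ᵛ Y → PathFreeOn Y m → PathFreeOn X m
  PathFreeOn-⊆ X⊆Y free xs (path d l inside) = free xs (path d l (λ v v∈ → X⊆Y v (inside v v∈)))

  -- p-regular with adjacency transitive on distinct vertices: a disjoint union of (p + 1)-cliques
  record CliqueUnion (p : ℕ) (X : Fin N → Bool) : Set where
    field
      regular : ∀ v → X v ≡ true → deg X v ≡ p
      transitive : ∀ {u v w} → X u ≡ true → X v ≡ true → X w ≡ true → Adj u v → Adj v w → u ≢ w → Adj u w
  open CliqueUnion public

  record ErdősGallai (p : ℕ) (X : Fin N → Bool) : Set where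
    field
      degSum≤ : degSum X ≤ p * card X
      extremal : degSum X ≡ p * card X → CliqueUnion p X
  open ErdősGallai public

  _∖_ : (Fin N → Bool) → (Fin N → Bool) → Fin N → Bool
  (X ∖ C) v = X v ∧ not (C v)

  ∖-⊆ : ∀ X C → (X ∖ C) ⊆ᵛ X
  ∖-⊆ X C v X∖Cv with X v
  ... | true = refl

  partition-∖ : ∀ {X C} → C ⊆ᵛ X → Partition X C (X ∖ C)
  partition-∖ {X} {C} C⊆X = partition split′
    where
    split′ : ∀ v → bit (X v) ≡ bit (C v) + bit (X v ∧ not (C v))
    split′ v with C v in Cv
    ... | true rewrite C⊆X v Cv = refl
    ... | false with X v
    ... | true = refl
    ... | false = refl

  partition-cases : ∀ {X Y Z v} → Partition X Y Z → X v ≡ true → (Y v ≡ true × Z v ≡ false) ⊎ (Y v ≡ false × Z v ≡ true)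
  partition-cases {X} {Y} {Z} {v} part Xv with X v | Y v | Z v | split part v
  ... | true | true | false | _ = inj₁ (refl , refl)
  ... | true | false | true | _ = inj₂ (refl , refl)

  no-edges : ∀ {X} → PathFreeOn X 2 → ∀ {u v} → X u ≡ true → X v ≡ true → adj Q u v ≡ false
  no-edges {X} free {u} {v} Xu Xv with adj Q u v in u~v
  ... | false = refl
  ... | true = ⊥-elim (free (u ∷ [ v ]) (path (Distinct-∷ (trans (+-identityʳ _) (cong bit (==-≢ u≢v))) (Distinct-[-] v)) (u~v ∷ [-]) inside) ≤-refl)
    where
    u≢v : u ≢ v
    u≢v refl = contradiction (trans (sym u~v) (irrefl Q u)) λ ()
    inside : ∀ w → w ∈ᴸ u ∷ [ v ] → X w ≡ true
    inside = inside-∷ {xs = [ v ]} Xu λ w w∈ → subst (λ w → X w ≡ true) (sym (∈-[-]⁻ w∈)) Xv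

  erdős-gallai-0 : ∀ {X} → PathFreeOn X 2 → ErdősGallai 0 X
  erdős-gallai-0 {X} free = record { degSum≤ = ≤-reflexive degSum≡0 ; extremal = λ _ → clique-union }
    where
    deg≡0 : ∀ v → X v ≡ true → deg X v ≡ 0
    deg≡0 v Xv = sum-zero {N} term≡0
      where
      term≡0 : ∀ u → bit (X u) * bit (adj Q v u) ≡ 0
      term≡0 u with X u in Xu
      ... | false = refl
      ... | true = trans (+-identityʳ _) (cong bit (no-edges free Xv Xu))
    degSum≡0 : degSum X ≡ 0
    degSum≡0 = sum-zero {N} term≡0
      where
      term≡0 : ∀ v → bit (X v) * deg X v ≡ 0
      term≡0 v with X v in Xv
      ... | false = refl
      ... | true = trans (+-identityʳ _) (deg≡0 v Xv)
    clique-union : CliqueUnion 0 X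
    clique-union = record
      { regular = deg≡0
      ; transitive = λ Xu Xv _ u~v _ _ → contradiction (trans (sym u~v) (no-edges free Xu Xv)) λ () }

  erdős-gallai-empty : ∀ {p X} → (∀ v → X v ≡ false) → ErdősGallai p X
  erdős-gallai-empty {p} {X} empty = record
    { degSum≤ = ≤-reflexive (trans degSum≡0 (sym (trans (cong (p *_) card≡0) (*-zeroʳ p))))
    ; extremal = λ _ → record
      { regular = λ v Xv → contradiction (trans (sym Xv) (empty v)) λ ()
      ; transitive = λ Xu _ _ _ _ _ → contradiction (trans (sym Xu) (empty _)) λ () } }
    where
    degSum≡0 : degSum X ≡ 0
    degSum≡0 = sum-zero {N} λ v → cong (λ b → bit b * deg X v) (empty v)
    card≡0 : card X ≡ 0
    card≡0 = sum-zero {N} λ v → cong bit (empty v)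

  card≤0⇒empty : ∀ X → card X ≤ 0 → ∀ v → X v ≡ false
  card≤0⇒empty X card≤0 v with X v in Xv
  ... | false = refl
  ... | true = contradiction (≤-trans (≤-reflexive (cong bit (sym Xv))) (≤-trans (term≤sum (λ w → bit (X w)) v) card≤0)) λ ()

  module _ {X : Fin N → Bool} {v : Fin N} (Xv : X v ≡ true) where

    private
      closed-neighbourhood : Fin N → ℕ
      closed-neighbourhood u = bit (X u) * bit (adj Q v u) + bit (u == v) * 1

      sum-closed-neighbourhood : sum closed-neighbourhood ≡ deg X v + 1
      sum-closed-neighbourhood = trans (∑-distrib-+ {N} _ _) (cong (deg X v +_) (sum-δ v λ _ → 1))

      closed-neighbourhood≤ : ∀ u → closed-neighbourhood u ≤ bit (X u)
      closed-neighbourhood≤ u with u == v in u=v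
      ... | true rewrite ==-true u=v | Xv | irrefl Q v = ≤-refl
      ... | false = ≤-trans (≤-reflexive (+-identityʳ _))
                      (≤-trans (*-monoʳ-≤ (bit (X u)) (bit≤1 (adj Q v u))) (≤-reflexive (*-identityʳ _)))

    deg+1≤card : deg X v + 1 ≤ card X
    deg+1≤card = ≤-trans (≤-reflexive (sym sum-closed-neighbourhood)) (sum-mono-≤ closed-neighbourhood≤)

    deg+1≡card⇒adjacent : deg X v + 1 ≡ card X → ∀ {u} → X u ≡ true → u ≢ v → Adj v u
    deg+1≡card⇒adjacent eq {u} Xu u≢v with sum-≤-equality closed-neighbourhood≤ (trans sum-closed-neighbourhood eq) u
    ... | term≡ rewrite Xu | ==-≢ u≢v with adj Q v u
    ... | true = refl

    complete⇒deg+1≡card : (∀ {u} → X u ≡ true → u ≢ v → Adj v u) → deg X v + 1 ≡ card X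
    complete⇒deg+1≡card complete = trans (sym sum-closed-neighbourhood) (sum-cong-≗ {N} termwise)
      where
      termwise : ∀ u → closed-neighbourhood u ≡ bit (X u)
      termwise u with u == v in u=v
      ... | true rewrite ==-true u=v | Xv | irrefl Q v = refl
      ... | false with X u in Xu
      ... | false = refl
      ... | true rewrite complete Xu (==-false u=v) = refl

  module _ (X : Fin N → Bool) where

    private
      weighted : ∑[ v < N ] (bit (X v) * (deg X v + 1)) ≡ degSum X + card X
      weighted = trans (sum-cong-≗ {N} λ v → trans (*-distribˡ-+ (bit (X v)) (deg X v) 1) (cong (bit (X v) * deg X v +_) (*-identityʳ _)))
                   (∑-distrib-+ {N} _ _)

      termwise : ∀ v → bit (X v) * (deg X v + 1) ≤ bit (X v) * card X
      termwise v with X v in Xv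
      ... | false = z≤n
      ... | true = *-monoʳ-≤ 1 (deg+1≤card Xv)

      squared : card X * card X ≡ ∑[ v < N ] (bit (X v) * card X)
      squared = *-distribʳ-sum (card X) (λ v → bit (X v))

    degSum+card≤card² : degSum X + card X ≤ card X * card X
    degSum+card≤card² = ≤-trans (≤-reflexive (sym weighted)) (≤-trans (sum-mono-≤ termwise) (≤-reflexive (sym squared)))

    degSum+card≡card²⇒deg+1≡card : degSum X + card X ≡ card X * card X → ∀ v → X v ≡ true → deg X v + 1 ≡ card X
    degSum+card≡card²⇒deg+1≡card eq v Xv with sum-≤-equality termwise (trans weighted (trans eq squared)) v
    ... | term≡ rewrite Xv = trans (sym (+-identityʳ _)) (trans term≡ (+-identityʳ _))

  module _ {p : ℕ} {C : Fin N → Bool} (small : card C ≤ suc p) where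

    small-set-bound : degSum C ≤ p * card C
    small-set-bound = +-cancelˡ-≤ (card C) _ _ (begin
      card C + degSum C   ≡⟨ +-comm (card C) (degSum C) ⟩
      degSum C + card C   ≤⟨ degSum+card≤card² C ⟩
      card C * card C     ≤⟨ *-monoˡ-≤ (card C) small ⟩
      suc p * card C      ∎)
      where open ≤-Reasoning

    small-set-extremal : 1 ≤ card C → degSum C ≡ p * card C → CliqueUnion p C
    small-set-extremal nonempty eq = record
      { regular = λ v Cv → suc-injective (trans (+-comm 1 _) (trans (full v Cv) full-size))
      ; transitive = λ {u} Cu _ Cw _ _ u≢w → deg+1≡card⇒adjacent Cu (full u Cu) Cw (u≢w ∘ sym) }
      where
      open ≤-Reasoning
      reached : suc p * card C ≤ card C * card C
      reached = begin
        suc p * card C      ≡⟨ +-comm (card C) (p * card C) ⟩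
        p * card C + card C ≡⟨ cong (_+ card C) eq ⟨
        degSum C + card C   ≤⟨ degSum+card≤card² C ⟩
        card C * card C     ∎
      full-size : card C ≡ suc p
      full-size = ≤-antisym small (*-cancelʳ-≤ (suc p) (card C) (card C) {{>-nonZero nonempty}} reached)
      full : ∀ v → C v ≡ true → deg C v + 1 ≡ card C
      full = degSum+card≡card²⇒deg+1≡card C (trans (cong (_+ card C) eq)
        (trans (+-comm (p * card C) (card C)) (cong (_* card C) (sym full-size))))

  neighbours : (Fin N → Bool) → Fin N → List (Fin N)
  neighbours Y u = select λ w → Y w ∧ adj Q u w

  ∈-neighbours⁻ : ∀ {Y u w} → w ∈ᴸ neighbours Y u → Y w ≡ true × Adj u w
  ∈-neighbours⁻ {Y} {u} {w} w∈ = let Yw∧u~w = ∈-select⁻ (λ w → Y w ∧ adj Q u w) w∈ in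
    ∧-conicalˡ (Y w) _ Yw∧u~w , ∧-conicalʳ (Y w) _ Yw∧u~w

  clique-path : ∀ {p Y u} → CliqueUnion p Y → Y u ≡ true → PathIn Y (u ∷ neighbours Y u) × length (u ∷ neighbours Y u) ≡ suc p
  clique-path {p} {Y} {u} cu Yu = path distinct′ (linked-clique _ distinct′ clique) inside , cong suc size
    where
    nbrs = neighbours Y u
    distinct′ : Distinct (u ∷ nbrs)
    distinct′ = Distinct-∷ (trans (occ-select (λ w → Y w ∧ adj Q u w) u) (trans (cong (λ b → bit (Y u ∧ b)) (irrefl Q u)) (cong bit (∧-zeroʳ (Y u)))))
                  (Distinct-select (λ w → Y w ∧ adj Q u w))
    in-closed-neighbourhood : ∀ {x} → x ∈ᴸ u ∷ nbrs → x ≡ u ⊎ (Y x ≡ true × Adj u x)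
    in-closed-neighbourhood {x} x∈ with ∈-∷⁻ {w = x} {x = u} {xs = nbrs} x∈
    ... | inj₁ x≡u = inj₁ x≡u
    ... | inj₂ x∈nbrs = inj₂ (∈-neighbours⁻ x∈nbrs)
    clique : ∀ {x y} → x ∈ᴸ u ∷ nbrs → y ∈ᴸ u ∷ nbrs → x ≢ y → Adj x y
    clique x∈ y∈ x≢y with in-closed-neighbourhood x∈ | in-closed-neighbourhood y∈
    ... | inj₁ refl | inj₁ refl = contradiction refl x≢y
    ... | inj₁ refl | inj₂ (_ , u~y) = u~y
    ... | inj₂ (_ , u~x) | inj₁ refl = Adj-sym u~x
    ... | inj₂ (Yx , u~x) | inj₂ (Yy , u~y) = transitive cu Yx Yu Yy (Adj-sym u~x) u~y x≢y
    inside : ∀ x → x ∈ᴸ u ∷ nbrs → Y x ≡ true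
    inside x x∈ with in-closed-neighbourhood x∈
    ... | inj₁ refl = Yu
    ... | inj₂ (Yx , _) = Yx
    size : length nbrs ≡ p
    size = trans (length-select (λ w → Y w ∧ adj Q u w)) (trans (sum-cong-≗ {N} λ w → bit-∧ (Y w) (adj Q u w)) (regular cu u Yu))

  clique-path-extension : ∀ {p X Y v₀} → CliqueUnion p Y → Y ⊆ᵛ X → X v₀ ≡ true → Y v₀ ≡ false → 1 ≤ deg Y v₀ →
    ∃ λ P → PathIn X P × length P ≡ 2 + p
  clique-path-extension {p} {X} {Y} {v₀} cu Y⊆X Xv₀ Yv₀ has-neighbour =
    v₀ ∷ u ∷ neighbours Y u , long-path , cong suc (proj₂ clique)
    where
    u-found = positive-term (λ u → bit (Y u) * bit (adj Q v₀ u)) has-neighbour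
    u = proj₁ u-found
    Yu×v₀~u : Y u ≡ true × Adj v₀ u
    Yu×v₀~u with Y u | adj Q v₀ u | proj₂ u-found
    ... | true | true | _ = refl , refl
    clique = clique-path cu (proj₁ Yu×v₀~u)
    P = proj₁ clique
    v₀∉ : ¬ v₀ ∈ᴸ u ∷ neighbours Y u
    v₀∉ v₀∈ = contradiction (trans (sym (path-inside P v₀ v₀∈)) Yv₀) λ ()
    long-path : PathIn X (v₀ ∷ u ∷ neighbours Y u)
    long-path = path (Distinct-∷ (∉⇒occ≡0 v₀ (u ∷ neighbours Y u) v₀∉) (path-distinct P)) (proj₂ Yu×v₀~u ∷ path-linked P)
      (inside-∷ {xs = u ∷ neighbours Y u} Xv₀ λ w w∈ → Y⊆X w (path-inside P w w∈))

  module _ (v : Fin N) where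

    card-singleton : card (_== v) ≡ 1
    card-singleton = trans (sum-cong-≗ {N} λ u → sym (*-identityʳ (bit (u == v)))) (sum-δ v λ _ → 1)

    deg-singleton : ∀ u → deg (_== v) u ≡ bit (adj Q u v)
    deg-singleton u = sum-δ v λ w → bit (adj Q u w)

    degSum-singleton : degSum (_== v) ≡ 0
    degSum-singleton = trans (sum-δ v (deg (_== v))) (trans (deg-singleton v) (cong bit (irrefl Q v)))

    cross-singleton : ∀ Y → cross (_== v) Y ≡ deg Y v
    cross-singleton Y = sum-δ v (deg Y)

  module _ (X : Fin N → Bool) {v₀ : Fin N} (Xv₀ : X v₀ ≡ true) where

    private
      part : Partition X (_== v₀) (X ∖ (_== v₀))
      part = partition-∖ λ v v=v₀ → subst (λ v → X v ≡ true) (sym (==-true v=v₀)) Xv₀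

    card-delete : card X ≡ card (X ∖ (_== v₀)) + 1
    card-delete = trans (card-partition part) (trans (cong (_+ card (X ∖ (_== v₀))) (card-singleton v₀)) (+-comm 1 _))

    deg-delete : deg X v₀ ≡ deg (X ∖ (_== v₀)) v₀
    deg-delete = trans (deg-partition part v₀) (cong (_+ deg (X ∖ (_== v₀)) v₀) (trans (deg-singleton v₀ v₀) (cong bit (irrefl Q v₀))))

    degSum-delete : degSum X ≡ degSum (X ∖ (_== v₀)) + 2 * deg X v₀
    degSum-delete = trans (degSum-partition part)
      (cong₂ (λ a b → a + degSum (X ∖ (_== v₀)) + 2 * b) (degSum-singleton v₀) (trans (cross-singleton v₀ (X ∖ (_== v₀))) (sym deg-delete)))

  Separated : (Fin N → Bool) → (Fin N → Bool) → Set
  Separated Y Z = ∀ {u w} → Y u ≡ true → Z w ≡ true → adj Q u w ≡ false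

  Separated-sym : ∀ {Y Z} → Separated Y Z → Separated Z Y
  Separated-sym sep Zu Yw = trans (symm Q _ _) (sep Yw Zu)

  Separated⇒deg≡0 : ∀ {Y Z v} → Separated Y Z → Y v ≡ true → deg Z v ≡ 0
  Separated⇒deg≡0 {Y} {Z} {v} sep Yv = sum-zero {N} term≡0
    where
    term≡0 : ∀ u → bit (Z u) * bit (adj Q v u) ≡ 0
    term≡0 u with Z u in Zu
    ... | false = refl
    ... | true = trans (+-identityʳ _) (cong bit (sep Yv Zu))

  Separated⇒cross≡0 : ∀ {Y Z} → Separated Y Z → cross Y Z ≡ 0
  Separated⇒cross≡0 {Y} {Z} sep = sum-zero {N} term≡0
    where
    term≡0 : ∀ v → bit (Y v) * deg Z v ≡ 0
    term≡0 v with Y v in Yv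
    ... | false = refl
    ... | true = trans (+-identityʳ _) (Separated⇒deg≡0 sep Yv)

  card-on-path : ∀ {C} → Distinct C → card (λ v → ⌊ v ∈ᴸ? C ⌋) ≡ length C
  card-on-path {C} d = trans (sum-cong-≗ {N} (bit-∈ᴸ? d)) (sum-occ C)

  closed⇒separated : ∀ {X C} → PathIn X C → Closed X C → Separated (λ v → ⌊ v ∈ᴸ? C ⌋) (X ∖ λ v → ⌊ v ∈ᴸ? C ⌋)
  closed⇒separated {X} {C} P closed {u} {w} InCu Yw with adj Q u w in u~w
  ... | false = refl
  ... | true = contradiction (closed (∖-⊆ X (λ v → ⌊ v ∈ᴸ? C ⌋) w Yw) (∈ᴸ?-sound {xs = C} InCu) u~w) w∉C
    where
    w∉C : ¬ w ∈ᴸ C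
    w∉C w∈ with w ∈ᴸ? C
    ... | yes _ = contradiction (∧-conicalʳ (X w) false Yw) λ ()
    ... | no w∉ = w∉ w∈

  CliqueUnion-partition : ∀ {p X Y Z} → Partition X Y Z → Separated Y Z →
    CliqueUnion p Y → CliqueUnion p Z → CliqueUnion p X
  CliqueUnion-partition {p} {X} {Y} {Z} part sep cuY cuZ = record { regular = regular′ ; transitive = transitive′ }
    where
    regular′ : ∀ v → X v ≡ true → deg X v ≡ p
    regular′ v Xv with partition-cases part Xv
    ... | inj₁ (Yv , _) = trans (deg-partition part v) (trans (cong (deg Y v +_) (Separated⇒deg≡0 sep Yv)) (trans (+-identityʳ _) (regular cuY v Yv)))
    ... | inj₂ (_ , Zv) = trans (deg-partition part v) (trans (cong (_+ deg Z v) (Separated⇒deg≡0 (Separated-sym sep) Zv)) (regular cuZ v Zv))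
    not-across : ∀ {u v} → Adj u v → (Y u ≡ true × Z v ≡ true) → ⊥
    not-across u~v (Yu , Zv) = contradiction (trans (sym u~v) (sep Yu Zv)) λ ()
    transitive′ : ∀ {u v w} → X u ≡ true → X v ≡ true → X w ≡ true → Adj u v → Adj v w → u ≢ w → Adj u w
    transitive′ Xu Xv Xw u~v v~w u≢w with partition-cases part Xu | partition-cases part Xv | partition-cases part Xw
    ... | inj₁ (Yu , _) | inj₁ (Yv , _) | inj₁ (Yw , _) = transitive cuY Yu Yv Yw u~v v~w u≢w
    ... | inj₂ (_ , Zu) | inj₂ (_ , Zv) | inj₂ (_ , Zw) = transitive cuZ Zu Zv Zw u~v v~w u≢w
    ... | inj₁ (Yu , _) | inj₂ (_ , Zv) | _ = ⊥-elim (not-across u~v (Yu , Zv))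
    ... | inj₂ (_ , Zu) | inj₁ (Yv , _) | _ = ⊥-elim (not-across (Adj-sym u~v) (Yv , Zu))
    ... | _ | inj₁ (Yv , _) | inj₂ (_ , Zw) = ⊥-elim (not-across v~w (Yv , Zw))
    ... | _ | inj₂ (_ , Zv) | inj₁ (Yw , _) = ⊥-elim (not-across (Adj-sym v~w) (Yw , Zv))

  module InductionStep (q : ℕ) (X : Fin N → Bool) (path-free : PathFreeOn X (3 + q))
              (IH : ∀ Y → card Y < card X → PathFreeOn Y (3 + q) → ErdősGallai (suc q) Y) where

    -- Deleting a vertex of degree at most (q + 1) / 2 keeps the bound; equality is impossible, since
    -- the vertex would extend a (q + 2)-clique of the remaining graph to a path on q + 3 vertices.
    low-degree : ∀ {v₀} → X v₀ ≡ true → 2 * deg X v₀ ≤ suc q → ErdősGallai (suc q) X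
    low-degree {v₀} Xv₀ small = record { degSum≤ = bound ; extremal = λ eq → ⊥-elim (not-extremal eq) }
      where
      X′ = X ∖ (_== v₀)
      eg′ : ErdősGallai (suc q) X′
      eg′ = IH X′ (≤-reflexive (trans (+-comm 1 _) (sym (card-delete X Xv₀)))) (PathFreeOn-⊆ (∖-⊆ X (_== v₀)) path-free)
      suc-q*card : suc q * card X ≡ suc q * card X′ + suc q
      suc-q*card = trans (cong (suc q *_) (card-delete X Xv₀))
        (trans (*-distribˡ-+ (suc q) (card X′) 1) (cong (suc q * card X′ +_) (*-identityʳ _)))
      bound : degSum X ≤ suc q * card X
      bound = ≤-trans (≤-reflexive (degSum-delete X Xv₀)) (≤-trans (+-mono-≤ (degSum≤ eg′) small) (≤-reflexive (sym suc-q*card)))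
      not-extremal : degSum X ≡ suc q * card X → ⊥
      not-extremal eq = path-free (proj₁ extended) (proj₁ (proj₂ extended)) (≤-reflexive (sym (proj₂ (proj₂ extended))))
        where
        tight = +-≤-equality (degSum≤ eg′) small (trans (sym (degSum-delete X Xv₀)) (trans eq suc-q*card))
        has-neighbour : 1 ≤ deg X′ v₀
        has-neighbour with deg X v₀ | deg-delete X Xv₀ | proj₂ tight
        ... | suc _ | d≡ | _ = subst (1 ≤_) d≡ (s≤s z≤n)
        extended = clique-path-extension (extremal eg′ (proj₁ tight)) (∖-⊆ X (_== v₀)) Xv₀
          (trans (cong (λ b → X v₀ ∧ not b) (==-refl v₀)) (∧-zeroʳ (X v₀))) has-neighbour

    -- With all degrees above (q + 1) / 2, Posa rotations produce a component C with at most q + 2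
    -- vertices; it contributes at most (q + 1) |C|, with equality only for a (q + 2)-clique.
    high-degree : (∀ v → X v ≡ true → suc (suc q) ≤ 2 * deg X v) → ∀ {v₀} → X v₀ ≡ true → ErdősGallai (suc q) X
    high-degree min-degree {v₀} Xv₀ = record { degSum≤ = bound ; extremal = extremal′ }
      where
      open Posa X (suc q) min-degree path-free
      found = closed-path-from v₀ Xv₀
      C = proj₁ found ∷ proj₁ (proj₂ found)
      P : PathIn X C
      P = proj₁ (proj₂ (proj₂ found))
      InC = λ v → ⌊ v ∈ᴸ? C ⌋
      Y = X ∖ InC
      part : Partition X InC Y
      part = partition-∖ λ v InCv → path-inside P v (∈ᴸ?-sound {xs = C} InCv)
      separated : Separated InC Y
      separated = closed⇒separated P (proj₂ (proj₂ (proj₂ found)))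
      card-InC : card InC ≡ length C
      card-InC = card-on-path (path-distinct P)
      small : card InC ≤ suc (suc q)
      small = subst (_≤ suc (suc q)) (sym card-InC) (length-bound P)
      card-X : card X ≡ card InC + card Y
      card-X = card-partition part
      degSum-X : degSum X ≡ degSum InC + degSum Y
      degSum-X = trans (degSum-partition part) (trans (cong (λ c → degSum InC + degSum Y + 2 * c) (Separated⇒cross≡0 separated)) (+-identityʳ _))
      egY : ErdősGallai (suc q) Y
      egY = IH Y (≤-trans (s≤s (m≤n+m (card Y) (length (proj₁ (proj₂ found)))))
                   (≤-reflexive (trans (cong (_+ card Y) (sym card-InC)) (sym card-X))))
                 (PathFreeOn-⊆ (∖-⊆ X InC) path-free)
      suc-q*card : suc q * card X ≡ suc q * card InC + suc q * card Y
      suc-q*card = trans (cong (suc q *_) card-X) (*-distribˡ-+ (suc q) (card InC) (card Y))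
      bound : degSum X ≤ suc q * card X
      bound = ≤-trans (≤-reflexive degSum-X) (≤-trans (+-mono-≤ (small-set-bound small) (degSum≤ egY)) (≤-reflexive (sym suc-q*card)))
      extremal′ : degSum X ≡ suc q * card X → CliqueUnion (suc q) X
      extremal′ eq = CliqueUnion-partition part separated
        (small-set-extremal small (subst (1 ≤_) (sym card-InC) (s≤s z≤n)) (proj₁ tight)) (extremal egY (proj₂ tight))
        where tight = +-≤-equality (small-set-bound small) (degSum≤ egY) (trans (sym degSum-X) (trans eq suc-q*card))

    erdős-gallai-step : ErdősGallai (suc q) X
    erdős-gallai-step with any? (λ v → (X v ≟ᵇ true) ×-dec (2 * deg X v ≤? suc q))
    ... | yes (v₀ , Xv₀ , small) = low-degree Xv₀ small
    ... | no no-small with any? (λ v → X v ≟ᵇ true)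
    ...   | no empty = erdős-gallai-empty λ v → ¬-not λ Xv → empty (v , Xv)
    ...   | yes (v₀ , Xv₀) = high-degree (λ v Xv → ≰⇒> λ small → no-small (v , Xv , small)) Xv₀

  erdős-gallai-bounded : ∀ size p X → card X ≤ size → PathFreeOn X (2 + p) → ErdősGallai p X
  erdős-gallai-bounded _ zero X _ free = erdős-gallai-0 free
  erdős-gallai-bounded zero (suc q) X small _ = erdős-gallai-empty (card≤0⇒empty X small)
  erdős-gallai-bounded (suc size) (suc q) X small free =
    InductionStep.erdős-gallai-step q X free λ Y smaller → erdős-gallai-bounded size (suc q) Y (≤-pred (≤-trans smaller small))

  erdős-gallai : ∀ p X → PathFreeOn X (2 + p) → ErdősGallai p X
  erdős-gallai p X = erdős-gallai-bounded (card X) p X ≤-refl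

induced : ∀ {n k} → Graph n → (Fin k → Fin n) → Graph k
induced G f = record { adj = λ a b → adj G (f a) (f b) ; symm = λ a b → symm G (f a) (f b) ; irrefl = λ a → irrefl G (f a) }

module Induced {n k : ℕ} (G : Graph n) (f : Fin k → Fin n) where
  open PathsIn (induced G f)

  record RouteTo (R : Fin k → Bool) (a : Fin k) : Set where
    constructor routeTo
    field
      route : List (Fin k)
      route-path : Path route
      route-starts : Head route a
      {target} : Fin k
      route-ends : Last route target
      target-in : R target ≡ true
      meets-once : ∀ v → v ∈ᴸ route → R v ≡ true → v ≡ target

  trivial-route : ∀ {R a} → R a ≡ true → RouteTo R a
  trivial-route {R} {a} Ra = routeTo [ a ] (path (Distinct-[-] a) [-] λ _ _ → refl) ([] , refl) last-[-] Ra
    λ v v∈ _ → ∈-[-]⁻ v∈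

  -- A walk to R is shortened to a path by cutting out the loop whenever a vertex repeats.
  route-to : ∀ R a c → Reach G f a c → R c ≡ true → RouteTo R a
  route-to R a .a (here .a) Rc = trivial-route Rc
  route-to R a c (step .a b .c a~b walk) Rc with R a in Ra
  ... | true = trivial-route Ra
  ... | false with route-to R b c walk Rc
  ... | routeTo π (path d l _) (π′ , refl) π-ends Rx once with a ∈ᴸ? π
  ...   | no a∉ = routeTo (a ∷ π) (path (Distinct-∷ (∉⇒occ≡0 a π a∉) d) (a~b ∷ l) λ _ _ → refl) (π , refl)
            (last-∷ π-ends) Rx once′
    where
    once′ : ∀ v → v ∈ᴸ a ∷ π → R v ≡ true → v ≡ _
    once′ v v∈ Rv with ∈-∷⁻ {w = v} {x = a} {xs = π} v∈
    ... | inj₁ refl = contradiction (trans (sym Rv) Ra) λ ()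
    ... | inj₂ v∈π = once v v∈π Rv
  ...   | yes a∈ with ∈-split π a∈
  ...     | π₁ , π₂ , π≡ = routeTo (a ∷ π₂)
              (path (Distinct-++⁻ʳ π₁ (subst Distinct π≡ d)) (Linked-++⁻ʳ π₁ (subst (Linked Adj) π≡ l)) λ _ _ → refl)
              (π₂ , refl) (Last-++⁻ π₁ (subst (λ l → Last l _) π≡ π-ends)) Rx
              λ v v∈ Rv → once v (subst (v ∈ᴸ_) (sym π≡) (∈-++⁺ʳ π₁ (a ∷ π₂) v∈)) Rv

  detour : ∀ R₁ x R₂ π {a} → Path (R₁ ++ x ∷ R₂) → Path π → Head π a → Last π x →
    (∀ v → v ∈ᴸ π → v ∈ᴸ R₁ ++ x ∷ R₂ → v ≡ x) → Path (R₁ ++ reverse π) × Last (R₁ ++ reverse π) a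
  detour R₁ x R₂ π (path dR lR _) (path dπ lπ _) π-starts π-ends meets =
    path (Distinct-++ (Distinct-++⁻ˡ R₁ dR) (Distinct-reverse dπ) disjoint)
         (Linked-++ (Linked-++⁻ˡ R₁ lR) (Linked-reverse Adj-sym lπ) junction) (λ _ _ → refl) ,
    Last-++ R₁ (Head⇒Last-reverse π-starts)
    where
    x∉R₁ : occ x R₁ ≡ 0
    x∉R₁ = n≤0⇒n≡0 (+-cancelʳ-≤ 1 (occ x R₁) 0 (≤-trans (+-monoʳ-≤ (occ x R₁) (s≤s z≤n))
      (subst (_≤ 1) (trans (occ-++ x R₁ (x ∷ R₂)) (cong (occ x R₁ +_) (occ-∷-self x R₂))) (occ≤1 dR x))))
    disjoint : ∀ v → v ∈ᴸ R₁ → occ v (reverse π) ≡ 0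
    disjoint v v∈R₁ = ∉⇒occ≡0 v (reverse π) λ v∈ →
      let v≡x = meets v (subst (1 ≤_) (occ-reverse v π) v∈) (∈-++⁺ˡ R₁ (x ∷ R₂) v∈R₁) in
      fresh⇒∉ x R₁ x∉R₁ (subst (_∈ᴸ R₁) v≡x v∈R₁)
    junction : ∀ {a b} → Last R₁ a → Head (reverse π) b → Adj a b
    junction l h = subst (Adj _) (Head-unique (Last⇒Head-reverse π-ends) h) (Linked-junction R₁ lR l)

  detour-bound : ∀ S₁ x S₂ π {a} → Path (S₁ ++ x ∷ S₂) → Path π → Head π a → Last π x →
    (∀ v → v ∈ᴸ π → v ∈ᴸ S₁ ++ x ∷ S₂ → v ≡ x) → length S₂ ≤ length S₁ →
    ∃ λ P → Path P × Last P a × suc (length S₁ + suc (length S₂)) ≤ 2 * length P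
  detour-bound S₁ x S₂ π PS Pπ π-starts π-ends meets S₂≤S₁ =
    S₁ ++ reverse π , proj₁ detoured , proj₂ detoured ,
    subst (λ m → suc (length S₁ + suc (length S₂)) ≤ 2 * m) (sym length-P)
      (longer-half (length S₁) (length S₂) (length π) S₂≤S₁ (Head⇒nonempty π-starts))
    where
    detoured = detour S₁ x S₂ π PS Pπ π-starts π-ends meets
    length-P : length (S₁ ++ reverse π) ≡ length S₁ + length π
    length-P = trans (List.length-++ S₁) (cong (length S₁ +_) (List.length-reverse π))

  -- The shortest route from a to a path R meets R in a vertex splitting R into two parts;
  -- following the longer part and then the route back gives a path ending at a.
  half-path : ConnectedOn G f → ∀ c R′ → Path (c ∷ R′) → ∀ a →
    ∃ λ P → Path P × Last P a × suc (length (c ∷ R′)) ≤ 2 * length P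
  half-path connected c R′ PR a with route-to (λ v → ⌊ v ∈ᴸ? (c ∷ R′) ⌋) a c (connected a c) (∈ᴸ?-complete {xs = c ∷ R′} (∈-head c R′))
  ... | routeTo π Pπ π-starts {x} π-ends Rx meets with ∈-split (c ∷ R′) (∈ᴸ?-sound {v = x} {xs = c ∷ R′} Rx)
  ... | R₁ , R₂ , R≡ with length R₂ ≤? length R₁
  ... | yes R₂≤R₁ = subst (λ m → ∃ λ P → Path P × Last P a × suc m ≤ 2 * length P)
          (sym (trans (cong length R≡) (List.length-++ R₁)))
          (detour-bound R₁ x R₂ π (subst Path R≡ PR) Pπ π-starts π-ends
            (λ v v∈π v∈R → meets v v∈π (∈ᴸ?-complete {xs = c ∷ R′} (subst (v ∈ᴸ_) (sym R≡) v∈R))) R₂≤R₁)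
  ... | no R₂≰R₁ = subst (λ m → ∃ λ P → Path P × Last P a × suc m ≤ 2 * length P)
          (sym (trans (cong length R≡) (trans (List.length-++ R₁) (+-suc-comm (length R₁) (length R₂)))))
          (subst₂ (λ m l → ∃ λ P → Path P × Last P a × suc (m + suc l) ≤ 2 * length P)
            (List.length-reverse R₂) (List.length-reverse R₁)
            (detour-bound (reverse R₂) x (reverse R₁) π (subst Path reverse-R≡ (PathIn-reverse PR)) Pπ π-starts π-ends
              (λ v v∈π v∈R → meets v v∈π (∈ᴸ?-complete {xs = c ∷ R′} (subst (1 ≤_) (trans (cong (occ v) (sym reverse-R≡)) (occ-reverse v (c ∷ R′))) v∈R)))
              (subst₂ _≤_ (sym (List.length-reverse R₁)) (sym (List.length-reverse R₂)) (<⇒≤ (≰⇒> R₂≰R₁)))))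
    where
    reverse-R≡ : reverse (c ∷ R′) ≡ reverse R₂ ++ x ∷ reverse R₁
    reverse-R≡ = begin
      reverse (c ∷ R′)              ≡⟨ cong reverse R≡ ⟩
      reverse (R₁ ++ x ∷ R₂)        ≡⟨ List.reverse-++ R₁ (x ∷ R₂) ⟩
      reverse (x ∷ R₂) ++ reverse R₁ ≡⟨ cong (_++ reverse R₁) (List.unfold-reverse x R₂) ⟩
      (reverse R₂ ∷ʳ x) ++ reverse R₁ ≡⟨ List.++-assoc (reverse R₂) [ x ] (reverse R₁) ⟩
      reverse R₂ ++ x ∷ reverse R₁  ∎
      where open ≡-Reasoning
    +-suc-comm : ∀ a b → a + suc b ≡ b + suc a
    +-suc-comm = solve-∀

∈?≡lookup : ∀ {n} (v : Fin n) (S : Subset n) → ⌊ v ∈? S ⌋ ≡ Vec.lookup S v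
∈?≡lookup zero (true ∷ S) = refl
∈?≡lookup zero (false ∷ S) = refl
∈?≡lookup (suc v) (_ ∷ S) with v ∈? S | ∈?≡lookup v S
... | yes _ | eq = eq
... | no _ | eq = eq

∣S∣≡sum : ∀ {n} (S : Subset n) → ∣ S ∣ ≡ ∑[ v < n ] bit (Vec.lookup S v)
∣S∣≡sum [] = refl
∣S∣≡sum (true ∷ S) = cong suc (∣S∣≡sum S)
∣S∣≡sum (false ∷ S) = ∣S∣≡sum S

module SymmetricCounting {n τ′ k : ℕ} (G : Graph n) (S : Subset n) (φ : Fin (suc τ′) → Fin k → Fin n)
  (φ-injective : ∀ i a j b → φ i a ≡ φ j b → i ≡ j × a ≡ b) (union : IsUnionOf S φ) where

  τ : ℕ
  τ = suc τ′

  inS : Fin n → Bool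
  inS = Vec.lookup S

  φ∈S : ∀ i a → inS (φ i a) ≡ true
  φ∈S i a = []=⇒lookup (proj₂ (union (φ i a)) i a)

  inS⇒φ : ∀ {v} → inS v ≡ true → ∃ λ i → ∃ λ a → φ i a ≡ v
  inS⇒φ {v} v∈S = proj₁ (union v) (lookup⇒[]= v S v∈S)

  ∉S⇒outside : ∀ {v} → inS v ≡ false → ∀ i a → φ i a ≢ v
  ∉S⇒outside {v} v∉S i a refl = contradiction (trans (sym (φ∈S i a)) v∉S) λ ()

  indicator-S : ∀ v → bit (inS v) ≡ ∑[ i < τ ] ∑[ a < k ] bit (v == φ i a)
  indicator-S v with inS v in v∈S
  ... | false = sym (sum-zero {τ} λ i → sum-zero {k} λ a → cong bit (==-≢ (≢-sym (∉S⇒outside v∈S i a))))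
  ... | true with inS⇒φ v∈S
  ... | i₀ , a₀ , refl = sym (begin
    ∑[ i < τ ] ∑[ a < k ] bit (φ i₀ a₀ == φ i a)        ≡⟨ sum-cong-≗ {τ} (λ i → sum-cong-≗ {k} λ a → only i a) ⟩
    ∑[ i < τ ] ∑[ a < k ] (bit (i == i₀) * bit (a == a₀)) ≡⟨ sum-cong-≗ {τ} (λ i → *-distribˡ-sum (bit (i == i₀)) λ a → bit (a == a₀)) ⟨
    ∑[ i < τ ] (bit (i == i₀) * ∑[ a < k ] bit (a == a₀)) ≡⟨ sum-δ i₀ (λ _ → ∑[ a < k ] bit (a == a₀)) ⟩
    ∑[ a < k ] bit (a == a₀)                             ≡⟨ sum-cong-≗ {k} (λ a → *-identityʳ (bit (a == a₀))) ⟨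
    ∑[ a < k ] (bit (a == a₀) * 1)                       ≡⟨ sum-δ a₀ (λ _ → 1) ⟩
    1                                                    ∎)
    where
    open ≡-Reasoning
    only : ∀ i a → bit (φ i₀ a₀ == φ i a) ≡ bit (i == i₀) * bit (a == a₀)
    only i a with i ≟ i₀ | a ≟ a₀
    ... | yes refl | yes refl = cong bit (==-refl (φ i a))
    ... | yes refl | no a≢a₀ = cong bit (==-≢ λ eq → a≢a₀ (sym (proj₂ (φ-injective i a₀ i a eq))))
    ... | no i≢i₀ | _ = cong bit (==-≢ λ eq → i≢i₀ (sym (proj₁ (φ-injective i₀ a₀ i a eq))))

  sum-over-S : ∀ (F : Fin n → ℕ) → ∑[ v < n ] (bit (inS v) * F v) ≡ ∑[ i < τ ] ∑[ a < k ] F (φ i a)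
  sum-over-S F = begin
    ∑[ v < n ] (bit (inS v) * F v)
      ≡⟨ sum-cong-≗ {n} (λ v → cong (_* F v) (indicator-S v)) ⟩
    ∑[ v < n ] ((∑[ i < τ ] ∑[ a < k ] bit (v == φ i a)) * F v)
      ≡⟨ sum-cong-≗ {n} (λ v → trans (*-distribʳ-sum (F v) (λ i → ∑[ a < k ] bit (v == φ i a)))
                                   (sum-cong-≗ {τ} λ i → *-distribʳ-sum (F v) λ a → bit (v == φ i a))) ⟩
    ∑[ v < n ] ∑[ i < τ ] ∑[ a < k ] (bit (v == φ i a) * F v)
      ≡⟨ ∑-comm {n} {τ} (λ v i → ∑[ a < k ] (bit (v == φ i a) * F v)) ⟩
    ∑[ i < τ ] ∑[ v < n ] ∑[ a < k ] (bit (v == φ i a) * F v)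
      ≡⟨ sum-cong-≗ {τ} (λ i → ∑-comm {n} {k} λ v a → bit (v == φ i a) * F v) ⟩
    ∑[ i < τ ] ∑[ a < k ] ∑[ v < n ] (bit (v == φ i a) * F v)
      ≡⟨ sum-cong-≗ {τ} (λ i → sum-cong-≗ {k} λ a → sum-δ (φ i a) F) ⟩
    ∑[ i < τ ] ∑[ a < k ] F (φ i a) ∎
    where open ≡-Reasoning

  ∣S∣≡τ*k : ∣ S ∣ ≡ τ * k
  ∣S∣≡τ*k = begin
    ∣ S ∣                                ≡⟨ ∣S∣≡sum S ⟩
    ∑[ v < n ] bit (inS v)               ≡⟨ sum-cong-≗ {n} (λ v → *-identityʳ (bit (inS v))) ⟨
    ∑[ v < n ] (bit (inS v) * 1)         ≡⟨ sum-over-S (λ _ → 1) ⟩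
    ∑[ i < τ ] ∑[ a < k ] 1              ≡⟨ sum-cong-≗ {τ} (λ i → trans (sum-const k 1) (*-identityʳ k)) ⟩
    ∑[ i < τ ] k                         ≡⟨ sum-const τ k ⟩
    τ * k                                ∎
    where open ≡-Reasoning

  module EdgeCounts (no-cross : NoCrossEdges G φ)
    (same-inside : ∀ i j a b → adj G (φ i a) (φ i b) ≡ adj G (φ j a) (φ j b))
    (same-outside : ∀ i j a (v : Fin n) → (∀ i′ a′ → φ i′ a′ ≢ v) → adj G (φ i a) v ≡ adj G (φ j a) v) where

    -- inner = 2 e(Q₁) and leaving = e(Q₁, V ∖ S)
    inner : ℕ
    inner = ∑[ a < k ] ∑[ b < k ] bit (adj G (φ zero a) (φ zero b))

    leaving : ℕ
    leaving = ∑[ a < k ] ∑[ v < n ] (bit (not (inS v)) * bit (adj G (φ zero a) v))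

    private
      h : Fin n → Fin n → ℕ
      h u v = bit (inS u) * (bit (inS v) * bit (adj G u v))

      lt : Fin n → Fin n → Bool
      lt u v = ⌊ toℕ u <? toℕ v ⌋

      h-sym : ∀ u v → h u v ≡ h v u
      h-sym u v = trans (cong (λ b → bit (inS u) * (bit (inS v) * bit b)) (symm G u v)) (*-left-comm (bit (inS u)) (bit (inS v)) _)

      h-split : ∀ u v → bit (lt u v) * h u v + bit (lt v u) * h u v ≡ h u v
      h-split u v with toℕ u <? toℕ v | toℕ v <? toℕ u
      ... | yes u<v | yes v<u = contradiction u<v (<-asym v<u)
      ... | yes _ | no _ = trans (+-identityʳ _) (+-identityʳ _)
      ... | no _ | yes _ = +-identityʳ _
      ... | no u≮v | no v≮u with toℕ-injective (≤-antisym (≮⇒≥ v≮u) (≮⇒≥ u≮v))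
      ... | refl = sym (trans (cong (λ b → bit (inS u) * (bit (inS u) * bit b)) (irrefl G u)) (vanish (bit (inS u)) (bit (inS u))))
        where
        vanish : ∀ a b → a * (b * 0) ≡ 0
        vanish = solve-∀

      ordered : ℕ
      ordered = ∑[ u < n ] ∑[ v < n ] (bit (lt u v) * h u v)

      eIn≡ordered : eIn G S ≡ ordered
      eIn≡ordered = trans (ΣFin≡sum λ u → ΣFin (pair u)) (sum-cong-≗ {n} λ u → trans (ΣFin≡sum (pair u)) (sum-cong-≗ {n} λ v → termwise u v))
        where
        pair : Fin n → Fin n → ℕ
        pair u v = bit (⌊ toℕ u <? toℕ v ⌋ ∧ ⌊ u ∈? S ⌋ ∧ ⌊ v ∈? S ⌋ ∧ adj G u v)
        termwise : ∀ u v → pair u v ≡ bit (lt u v) * h u v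
        termwise u v rewrite bit-∧ (lt u v) (⌊ u ∈? S ⌋ ∧ ⌊ v ∈? S ⌋ ∧ adj G u v) | bit-∧ ⌊ u ∈? S ⌋ (⌊ v ∈? S ⌋ ∧ adj G u v)
                           | bit-∧ ⌊ v ∈? S ⌋ (adj G u v) | ∈?≡lookup u S | ∈?≡lookup v S = refl

      2*ordered : 2 * ordered ≡ ∑[ u < n ] ∑[ v < n ] h u v
      2*ordered = begin
        2 * ordered                 ≡⟨ cong (ordered +_) (+-identityʳ ordered) ⟩
        ordered + ordered           ≡⟨ cong (ordered +_) mirrored ⟩
        ordered + ∑[ u < n ] ∑[ v < n ] (bit (lt v u) * h u v)
          ≡⟨ ∑-distrib-+ {n} _ _ ⟨
        ∑[ u < n ] (∑[ v < n ] (bit (lt u v) * h u v) + ∑[ v < n ] (bit (lt v u) * h u v))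
          ≡⟨ sum-cong-≗ {n} (λ u → trans (sym (∑-distrib-+ {n} _ _)) (sum-cong-≗ {n} (h-split u))) ⟩
        ∑[ u < n ] ∑[ v < n ] h u v ∎
        where
        open ≡-Reasoning
        mirrored : ordered ≡ ∑[ u < n ] ∑[ v < n ] (bit (lt v u) * h u v)
        mirrored = trans (sum-cong-≗ {n} λ u → sum-cong-≗ {n} λ v → cong (bit (lt u v) *_) (h-sym u v))
                     (∑-comm {n} {n} λ u v → bit (lt u v) * h v u)

      own-copy : ∀ i (T : Fin τ → ℕ) → (∀ j → i ≢ j → T j ≡ 0) → sum T ≡ T i
      own-copy i T others = trans (sum-cong-≗ {τ} only-i) (sum-δ i T)
        where
        only-i : ∀ j → T j ≡ bit (j == i) * T j
        only-i j with j ≟ i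
        ... | yes refl = sym (+-identityʳ _)
        ... | no j≢i = others j (≢-sym j≢i)

      sum-h : ∑[ u < n ] ∑[ v < n ] h u v ≡ τ * inner
      sum-h = begin
        ∑[ u < n ] ∑[ v < n ] h u v
          ≡⟨ sum-cong-≗ {n} (λ u → *-distribˡ-sum (bit (inS u)) λ v → bit (inS v) * bit (adj G u v)) ⟨
        ∑[ u < n ] (bit (inS u) * ∑[ v < n ] (bit (inS v) * bit (adj G u v)))
          ≡⟨ sum-over-S (λ u → ∑[ v < n ] (bit (inS v) * bit (adj G u v))) ⟩
        ∑[ i < τ ] ∑[ a < k ] ∑[ v < n ] (bit (inS v) * bit (adj G (φ i a) v))
          ≡⟨ sum-cong-≗ {τ} (λ i → sum-cong-≗ {k} λ a → sum-over-S λ v → bit (adj G (φ i a) v)) ⟩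
        ∑[ i < τ ] ∑[ a < k ] ∑[ j < τ ] ∑[ b < k ] bit (adj G (φ i a) (φ j b))
          ≡⟨ sum-cong-≗ {τ} (λ i → sum-cong-≗ {k} λ a → own-copy i _ λ j i≢j → sum-zero {k} λ b → cong bit (no-cross i j a b i≢j)) ⟩
        ∑[ i < τ ] ∑[ a < k ] ∑[ b < k ] bit (adj G (φ i a) (φ i b))
          ≡⟨ sum-cong-≗ {τ} (λ i → sum-cong-≗ {k} λ a → sum-cong-≗ {k} λ b → cong bit (same-inside i zero a b)) ⟩
        ∑[ i < τ ] inner
          ≡⟨ sum-const τ inner ⟩
        τ * inner ∎
        where open ≡-Reasoning

    2*eIn≡ : 2 * eIn G S ≡ τ * inner
    2*eIn≡ = trans (cong (2 *_) eIn≡ordered) (trans 2*ordered sum-h)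

    eOut≡ : eOut G S ≡ τ * leaving
    eOut≡ = begin
      eOut G S
        ≡⟨ trans (ΣFin≡sum λ u → ΣFin (pair u)) (sum-cong-≗ {n} λ u → trans (ΣFin≡sum (pair u)) (sum-cong-≗ {n} λ v → termwise u v)) ⟩
      ∑[ u < n ] ∑[ v < n ] (bit (inS u) * (bit (not (inS v)) * bit (adj G u v)))
        ≡⟨ sum-cong-≗ {n} (λ u → *-distribˡ-sum (bit (inS u)) λ v → bit (not (inS v)) * bit (adj G u v)) ⟨
      ∑[ u < n ] (bit (inS u) * ∑[ v < n ] (bit (not (inS v)) * bit (adj G u v)))
        ≡⟨ sum-over-S (λ u → ∑[ v < n ] (bit (not (inS v)) * bit (adj G u v))) ⟩
      ∑[ i < τ ] ∑[ a < k ] ∑[ v < n ] (bit (not (inS v)) * bit (adj G (φ i a) v))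
        ≡⟨ sum-cong-≗ {τ} (λ i → sum-cong-≗ {k} λ a → sum-cong-≗ {n} λ v → as-in-copy-0 i a v) ⟩
      ∑[ i < τ ] leaving
        ≡⟨ sum-const τ leaving ⟩
      τ * leaving ∎
      where
      open ≡-Reasoning
      pair : Fin n → Fin n → ℕ
      pair u v = bit (⌊ u ∈? S ⌋ ∧ not ⌊ v ∈? S ⌋ ∧ adj G u v)
      termwise : ∀ u v → pair u v ≡ bit (inS u) * (bit (not (inS v)) * bit (adj G u v))
      termwise u v rewrite bit-∧ ⌊ u ∈? S ⌋ (not ⌊ v ∈? S ⌋ ∧ adj G u v) | bit-∧ (not ⌊ v ∈? S ⌋) (adj G u v)
                         | ∈?≡lookup u S | ∈?≡lookup v S = refl
      as-in-copy-0 : ∀ i a v → bit (not (inS v)) * bit (adj G (φ i a) v) ≡ bit (not (inS v)) * bit (adj G (φ zero a) v)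
      as-in-copy-0 i a v with inS v in v∈S
      ... | true = refl
      ... | false = cong (λ b → bit b + 0) (same-outside i zero a v (∉S⇒outside v∈S))

module Weaving {n τ′ k : ℕ} (G : Graph n) (φ : Fin (suc τ′) → Fin k → Fin n)
  (φ-injective : ∀ i a j b → φ i a ≡ φ j b → i ≡ j × a ≡ b)
  (same-inside : ∀ i j a b → adj G (φ i a) (φ i b) ≡ adj G (φ j a) (φ j b))
  (same-outside : ∀ i j a (v : Fin n) → (∀ i′ a′ → φ i′ a′ ≢ v) → adj G (φ i a) v ≡ adj G (φ j a) v)
  (connected : ConnectedOn G (φ zero))
  (att : Fin n → Fin k) where

  private
    τ : ℕ
    τ = suc τ′

  module Q = PathsIn (induced G (φ zero))
  module 𝔾 = PathsIn G
  open Induced G (φ zero) using (RouteTo; route-to; routeTo)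

  Outside : Fin n → Set
  Outside v = ∀ i a → φ i a ≢ v

  record Attached (ws : List (Fin n)) : Set where
    field
      attached-distinct : Distinct ws
      attached-outside : ∀ w → w ∈ᴸ ws → Outside w
      attached-adjacent : ∀ w → w ∈ᴸ ws → adj G (φ zero (att w)) w ≡ true
  open Attached

  Attached-tail : ∀ {w ws} → Attached (w ∷ ws) → Attached ws
  Attached-tail {w} {ws} A = record
    { attached-distinct = Distinct-tail (attached-distinct A)
    ; attached-outside = λ v v∈ → attached-outside A v (∈-tail w ws v∈)
    ; attached-adjacent = λ v v∈ → attached-adjacent A v (∈-tail w ws v∈) }

  Attached-prefix : ∀ ws {vs} → Attached (ws ++ vs) → Attached ws
  Attached-prefix ws {vs} A = record
    { attached-distinct = Distinct-++⁻ˡ ws (attached-distinct A)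
    ; attached-outside = λ w w∈ → attached-outside A w (∈-++⁺ˡ ws vs w∈)
    ; attached-adjacent = λ w w∈ → attached-adjacent A w (∈-++⁺ˡ ws vs w∈) }

  -- the c-th copy, for c < τ (copy c = zero is a junk value otherwise)
  copy : ℕ → Fin τ
  copy c with c <? τ
  ... | yes c<τ = fromℕ< c<τ
  ... | no _ = zero

  copy-injective : ∀ {c c′} → c < τ → c′ < τ → copy c ≡ copy c′ → c ≡ c′
  copy-injective {c} {c′} c<τ c′<τ eq = trans (sym (toℕ-copy c<τ)) (trans (cong toℕ eq) (toℕ-copy c′<τ))
    where
    toℕ-copy : ∀ {c} → c < τ → toℕ (copy c) ≡ c
    toℕ-copy {c} c<τ with c <? τ
    ... | yes c<τ′ = toℕ-fromℕ< c<τ′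
    ... | no c≮τ = contradiction c<τ c≮τ

  lift : ∀ i {P} → Q.Path P → Distinct (map (φ i) P) × Linked 𝔾.Adj (map (φ i) P)
  lift i (Q.path d l _) =
    Distinct-map (φ i) (λ a b eq → proj₂ (φ-injective i a i b eq)) d ,
    map⁺ (Linked-map (λ {a} {b} a~b → trans (same-inside i zero a b) a~b) l)

  outside-lift : ∀ i {w} P → Outside w → occ w (map (φ i) P) ≡ 0
  outside-lift i {w} P out = ∉⇒occ≡0 w (map (φ i) P) λ w∈ → let a , φa≡w , _ = ∈-map⁻ (φ i) P w∈ in out i a φa≡w

  adjacent-in-copy : ∀ i {w} → Outside w → adj G (φ zero (att w)) w ≡ true → 𝔾.Adj w (φ i (att w))
  adjacent-in-copy i {w} out att~w = 𝔾.Adj-sym (trans (same-outside i zero (att w) w out) att~w)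

  segment : Fin k → Fin k → List (Fin k)
  segment a b = RouteTo.route (route-to (_== b) a b (connected a b) (==-refl b))

  segment-path : ∀ a b → Q.Path (segment a b) × Head (segment a b) a × Last (segment a b) b
  segment-path a b with route-to (_== b) a b (connected a b) (==-refl b)
  ... | routeTo π P π-starts π-ends x=b _ = P , π-starts , subst (Last π) (==-true x=b) π-ends

  Ends : ℕ → Set
  Ends M = ∀ a → ∃ λ P → Q.Path P × Last P a × M ≤ 2 * length P

  InCopies : ℕ → Fin n → Set
  InCopies c v = ∃ λ j → ∃ λ a → c ≤ j × j < τ × φ (copy j) a ≡ v

  earlier-copy : ∀ {c v a} → c < τ → φ (copy c) a ≡ v → ¬ InCopies (suc c) v
  earlier-copy {c} c<τ φa≡v (j , b , c<j , j<τ , φb≡v) =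
    <-irrefl (sym (copy-injective j<τ c<τ (proj₁ (φ-injective (copy j) b (copy c) _ (trans φb≡v (sym φa≡v)))))) c<j

  module Weave {M : ℕ} (ends : Ends M) where

    start : Fin k → List (Fin k)
    start a = reverse (proj₁ (ends a))

    start-path : ∀ a → Q.Path (start a) × Head (start a) a × M ≤ 2 * length (start a)
    start-path a with ends a
    ... | P , PP , P-ends , long =
      Q.PathIn-reverse PP , Last⇒Head-reverse P-ends , subst (λ m → M ≤ 2 * m) (sym (List.length-reverse P)) long

    -- w₁ Q_c w₂ Q_{c+1} … w_m Q_{c+m-1}: each outside vertex enters a fresh copy at its attachment
    -- vertex, the segment there leads to the attachment vertex of the next one, and the last copy
    -- is left along a long path.
    tail : ℕ → Fin n → List (Fin n) → List (Fin n)
    tail c w [] = w ∷ map (φ (copy c)) (start (att w))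
    tail c w (w′ ∷ ws) = w ∷ map (φ (copy c)) (segment (att w) (att w′)) ++ tail (suc c) w′ ws

    tail-head : ∀ c w ws → Head (tail c w ws) w
    tail-head c w [] = _ , refl
    tail-head c w (_ ∷ _) = _ , refl

    record TailInvariant (c : ℕ) (w : Fin n) (ws : List (Fin n)) : Set where
      field
        tail-distinct : Distinct (tail c w ws)
        tail-linked : Linked 𝔾.Adj (tail c w ws)
        tail-vertices : ∀ v → v ∈ᴸ tail c w ws → v ∈ᴸ w ∷ ws ⊎ InCopies c v
        tail-long : M + 4 * length (w ∷ ws) ≤ 2 * length (tail c w ws) + 2
    open TailInvariant

    tail-invariant : ∀ c w ws → c + length ws < τ → Attached (w ∷ ws) → TailInvariant c w ws
    tail-invariant c w [] c<τ A = record
      { tail-distinct = Distinct-∷ (outside-lift (copy c) P (attached-outside A w w∈)) (proj₁ lifted)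
      ; tail-linked = Linked-∷ (adjacent-in-copy (copy c) (attached-outside A w w∈) (attached-adjacent A w w∈))
                        (Head-map (φ (copy c)) P-starts) (proj₂ lifted)
      ; tail-vertices = vertices
      ; tail-long = subst (λ m → M + 4 * 1 ≤ 2 * suc m + 2) (sym (List.length-map (φ (copy c)) P)) (woven-length-base M (length P) long) }
      where
      w∈ = ∈-head w []
      P = start (att w)
      P-starts = proj₁ (proj₂ (start-path (att w)))
      long = proj₂ (proj₂ (start-path (att w)))
      lifted = lift (copy c) (proj₁ (start-path (att w)))
      vertices : ∀ v → v ∈ᴸ tail c w [] → v ∈ᴸ [ w ] ⊎ InCopies c v
      vertices v v∈ with ∈-∷⁻ {w = v} {x = w} {xs = map (φ (copy c)) P} v∈
      ... | inj₁ refl = inj₁ w∈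
      ... | inj₂ v∈P = let a , φa≡v , _ = ∈-map⁻ (φ (copy c)) P v∈P in
        inj₂ (c , a , ≤-refl , subst (_< τ) (+-identityʳ c) c<τ , φa≡v)
    tail-invariant c w (w′ ∷ ws) bound A = record
      { tail-distinct = Distinct-∷ w-fresh (Distinct-++ (proj₁ lifted) (tail-distinct IH) disjoint)
      ; tail-linked = Linked-∷ (adjacent-in-copy (copy c) (out w w∈) (attached-adjacent A w w∈))
                        (Head-++ R (Head-map (φ (copy c)) (proj₁ (proj₂ S-path))))
                        (Linked-++ (proj₂ lifted) (tail-linked IH) junction)
      ; tail-vertices = vertices
      ; tail-long = subst (λ m → M + 4 * length (w ∷ w′ ∷ ws) ≤ 2 * suc m + 2) (sym length-L)
                      (woven-length-step M (length (w′ ∷ ws)) (length S) (length R) (tail-long IH) (Head⇒nonempty (proj₁ (proj₂ S-path)))) }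
      where
      w∈ = ∈-head w (w′ ∷ ws)
      w′∈ = ∈-tail w (w′ ∷ ws) (∈-head w′ ws)
      out = attached-outside A
      c<τ : c < τ
      c<τ = ≤-trans (s≤s (m≤m+n c (length (w′ ∷ ws)))) bound
      IH = tail-invariant (suc c) w′ ws (subst (_< τ) (+-suc c (length ws)) bound) (Attached-tail A)
      S = segment (att w) (att w′)
      S-path = segment-path (att w) (att w′)
      lifted = lift (copy c) (proj₁ S-path)
      R = tail (suc c) w′ ws
      length-L : length (map (φ (copy c)) S ++ R) ≡ length S + length R
      length-L = trans (List.length-++ (map (φ (copy c)) S)) (cong (_+ length R) (List.length-map (φ (copy c)) S))
      junction : ∀ {a b} → Last (map (φ (copy c)) S) a → Head R b → 𝔾.Adj a b
      junction l h = subst₂ 𝔾.Adj (Last-unique (Last-map (φ (copy c)) (proj₂ (proj₂ S-path))) l) (Head-unique (tail-head (suc c) w′ ws) h)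
        (𝔾.Adj-sym (adjacent-in-copy (copy c) (out w′ w′∈) (attached-adjacent A w′ w′∈)))
      disjoint : ∀ v → v ∈ᴸ map (φ (copy c)) S → occ v R ≡ 0
      disjoint v v∈ = ∉⇒occ≡0 v R λ v∈R → let a , φa≡v , _ = ∈-map⁻ (φ (copy c)) S v∈ in
        [ (λ v∈ws → out v (∈-tail w (w′ ∷ ws) v∈ws) (copy c) a φa≡v) , earlier-copy c<τ φa≡v ]′ (tail-vertices IH v v∈R)
      w-fresh : occ w (map (φ (copy c)) S ++ R) ≡ 0
      w-fresh = trans (occ-++ w (map (φ (copy c)) S) R) (cong₂ _+_ (outside-lift (copy c) S (out w w∈))
        (∉⇒occ≡0 w R λ w∈R → [ fresh⇒∉ w (w′ ∷ ws) (Distinct-fresh (attached-distinct A))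
                              , (λ { (j , b , _ , _ , φb≡w) → out w w∈ (copy j) b φb≡w }) ]′ (tail-vertices IH w w∈R)))
      vertices : ∀ v → v ∈ᴸ tail c w (w′ ∷ ws) → v ∈ᴸ w ∷ w′ ∷ ws ⊎ InCopies c v
      vertices v v∈ with ∈-∷⁻ {w = v} {x = w} {xs = map (φ (copy c)) S ++ R} v∈
      ... | inj₁ refl = inj₁ w∈
      ... | inj₂ v∈L with ∈-++⁻ (map (φ (copy c)) S) R v∈L
      ... | inj₁ v∈S = let a , φa≡v , _ = ∈-map⁻ (φ (copy c)) S v∈S in inj₂ (c , a , ≤-refl , c<τ , φa≡v)
      ... | inj₂ v∈R with tail-vertices IH v v∈R
      ... | inj₁ v∈ws = inj₁ (∈-tail w (w′ ∷ ws) v∈ws)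
      ... | inj₂ (j , b , c<j , j<τ , φb≡v) = inj₂ (j , b , <⇒≤ c<j , j<τ , φb≡v)

    weave : ∀ w ws → suc (length ws) < τ → Attached (w ∷ ws) →
      ∃ λ P → 𝔾.Path P × M + M + 4 * length (w ∷ ws) ≤ 2 * length P + 2
    weave w ws bound A = E′ ++ T , 𝔾.path distinct′ linked′ (λ _ _ → refl) , long
      where
      w∈ = ∈-head w ws
      E = proj₁ (ends (att w))
      E-path = proj₁ (proj₂ (ends (att w)))
      E-ends = proj₁ (proj₂ (proj₂ (ends (att w))))
      E-long = proj₂ (proj₂ (proj₂ (ends (att w))))
      E′ = map (φ (copy 0)) E
      T = tail 1 w ws
      inv = tail-invariant 1 w ws bound A
      lifted = lift (copy 0) E-path
      junction : ∀ {a b} → Last E′ a → Head T b → 𝔾.Adj a b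
      junction l h = subst₂ 𝔾.Adj (Last-unique (Last-map (φ (copy 0)) E-ends) l) (Head-unique (tail-head 1 w ws) h)
        (𝔾.Adj-sym (adjacent-in-copy (copy 0) (attached-outside A w w∈) (attached-adjacent A w w∈)))
      disjoint : ∀ v → v ∈ᴸ E′ → occ v T ≡ 0
      disjoint v v∈ = ∉⇒occ≡0 v T λ v∈T → let a , φa≡v , _ = ∈-map⁻ (φ (copy 0)) E v∈ in
        [ (λ v∈ws → attached-outside A v v∈ws (copy 0) a φa≡v) , earlier-copy (s≤s z≤n) φa≡v ]′ (tail-vertices inv v v∈T)
      distinct′ : Distinct (E′ ++ T)
      distinct′ = Distinct-++ (proj₁ lifted) (tail-distinct inv) disjoint
      linked′ : Linked 𝔾.Adj (E′ ++ T)
      linked′ = Linked-++ (proj₂ lifted) (tail-linked inv) junction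
      long : M + M + 4 * length (w ∷ ws) ≤ 2 * length (E′ ++ T) + 2
      long = begin
        M + M + 4 * length (w ∷ ws)     ≡⟨ +-assoc M M _ ⟩
        M + (M + 4 * length (w ∷ ws))   ≤⟨ +-mono-≤ E-long (tail-long inv) ⟩
        2 * length E + (2 * length T + 2) ≡⟨ regroup (length E) (length T) ⟩
        2 * (length E + length T) + 2   ≡⟨ cong (λ m → 2 * m + 2) length-P ⟨
        2 * length (E′ ++ T) + 2        ∎
        where
        open ≤-Reasoning
        regroup : ∀ e t → 2 * e + (2 * t + 2) ≡ 2 * (e + t) + 2
        regroup = solve-∀
        length-P : length (E′ ++ T) ≡ length E + length T
        length-P = trans (List.length-++ E′) (cong (_+ length T) (List.length-map (φ (copy 0)) E))

-- L = ℓ - 2, the copies are Qᵢ = φ i, τ = suc τ′ and k = suc k′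
module Lemma3p7 (L n : ℕ) (G : Graph n) (S : Subset n) (τ′ k′ : ℕ) (φ : Fin (suc τ′) → Fin (suc k′) → Fin n)
  (path-free : PathFree G (2 + L))
  (φ-injective : ∀ i a j b → φ i a ≡ φ j b → i ≡ j × a ≡ b)
  (connected : ∀ i → ConnectedOn G (φ i))
  (same-inside : ∀ i j a b → adj G (φ i a) (φ i b) ≡ adj G (φ j a) (φ j b))
  (same-outside : ∀ i j a (v : Fin n) → (∀ i′ a′ → φ i′ a′ ≢ v) → adj G (φ i a) v ≡ adj G (φ j a) v)
  (union : IsUnionOf S φ) (no-cross : NoCrossEdges G φ)
  (many-copies : 2 + L ≤ suc τ′)
  (dense : L * ∣ S ∣ ≤ 2 * (eIn G S + eOut G S)) where

  k : ℕ
  k = suc k′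

  open SymmetricCounting G S φ φ-injective union
  open EdgeCounts no-cross same-inside same-outside

  -- a neighbour of v in Q₁ = φ zero if there is one (zero otherwise)
  att : Fin n → Fin k
  att v with any? (λ a → adj G (φ zero a) v ≟ᵇ true)
  ... | yes (a , _) = a
  ... | no _ = zero

  attached : Fin n → Bool
  attached v = not (inS v) ∧ ⌊ any? (λ a → adj G (φ zero a) v ≟ᵇ true) ⌋

  W : List (Fin n)
  W = select attached

  t : ℕ
  t = length W

  open Weaving G φ φ-injective same-inside same-outside (connected zero) att

  W-attached : Attached W
  W-attached = record
    { attached-distinct = Distinct-select attached
    ; attached-outside = λ w w∈ → ∉S⇒outside (outside w (∈-select⁻ attached w∈))
    ; attached-adjacent = λ w w∈ → adjacent w (∈-select⁻ attached w∈) }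
    where
    outside : ∀ w → attached w ≡ true → inS w ≡ false
    outside w aw with inS w | aw
    ... | false | _ = refl
    adjacent : ∀ w → attached w ≡ true → adj G (φ zero (att w)) w ≡ true
    adjacent w aw with any? (λ a → adj G (φ zero a) w ≟ᵇ true) | ∧-conicalʳ (not (inS w)) _ aw
    ... | yes (_ , w~a) | _ = w~a

  leaving≤t*k : leaving ≤ t * k
  leaving≤t*k = begin
    leaving                                      ≡⟨ ∑-comm {k} {n} (λ a v → bit (not (inS v)) * bit (adj G (φ zero a) v)) ⟩
    ∑[ v < n ] ∑[ a < k ] (bit (not (inS v)) * bit (adj G (φ zero a) v))
                                                 ≤⟨ sum-mono-≤ at-most-k ⟩
    ∑[ v < n ] (bit (attached v) * k)            ≡⟨ *-distribʳ-sum k (λ v → bit (attached v)) ⟨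
    (∑[ v < n ] bit (attached v)) * k            ≡⟨ cong (_* k) (length-select attached) ⟨
    t * k                                        ∎
    where
    open ≤-Reasoning
    at-most-k : ∀ v → ∑[ a < k ] (bit (not (inS v)) * bit (adj G (φ zero a) v)) ≤ bit (attached v) * k
    at-most-k v with inS v
    ... | true = ≤-reflexive (sum-zero {k} λ _ → refl)
    ... | false with any? (λ a → adj G (φ zero a) v ≟ᵇ true)
    ... | yes _ = ≤-trans (sum-mono-≤ {k} {g = λ _ → 1} λ a → ≤-trans (≤-reflexive (+-identityʳ _)) (bit≤1 (adj G (φ zero a) v)))
                    (≤-reflexive (trans (sum-const k 1) (trans (*-identityʳ k) (sym (+-identityʳ k)))))
    ... | no none = ≤-reflexive (sum-zero {k} λ a → trans (+-identityʳ _) (cong bit (¬-not λ v~a → none (a , v~a))))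

  open Weave using (weave)

  no-long-path : ∀ {P} → 𝔾.Path P → 2 + L ≤ length P → ⊥
  no-long-path P long = path-free (𝔾.path⇒ContainsPath P long)

  single-ends : Ends 2
  single-ends a = [ a ] , Q.path (Distinct-[-] a) [-] (λ _ _ → refl) , last-[-] , ≤-refl

  few-attached : t ≤ L
  few-attached with t ≤? L
  ... | yes t≤L = t≤L
  ... | no t≰L with take (suc L) W | List.take++drop≡id (suc L) W | List.length-take (suc L) W
  ... | [] | _ | length-[] = contradiction (trans length-[] (m≤n⇒m⊓n≡m (≰⇒> t≰L))) λ ()
  ... | w ∷ ws | W≡ | length-ws = ⊥-elim (no-long-path (proj₁ (proj₂ woven)) (*-cancelˡ-≤ 2 (+-cancelʳ-≤ 2 _ _ bound)))
    where
    |ws|≡L : length ws ≡ L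
    |ws|≡L = suc-injective (trans length-ws (m≤n⇒m⊓n≡m (≰⇒> t≰L)))
    woven = weave single-ends w ws (subst (_< suc τ′) (sym (cong suc |ws|≡L)) many-copies)
              (Attached-prefix (w ∷ ws) (subst Attached (sym W≡) W-attached))
    bound : 2 * (2 + L) + 2 ≤ 2 * length (proj₁ woven) + 2
    bound = ≤-trans (arithmetic L) (subst (λ m → 2 + 2 + 4 * suc m ≤ 2 * length (proj₁ woven) + 2) |ws|≡L (proj₂ (proj₂ woven)))
      where
      arithmetic : ∀ L → 2 * (2 + L) + 2 ≤ 2 + 2 + 4 * suc L
      arithmetic L = ≤-trans (m≤m+n _ (2 * L + 2)) (≤-reflexive (regroup L))
        where
        regroup : ∀ L → 2 * (2 + L) + 2 + (2 * L + 2) ≡ 2 + 2 + 4 * suc L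
        regroup = solve-∀

  fewer-than-copies : t < suc τ′
  fewer-than-copies = ≤-trans (s≤s (≤-trans few-attached (n≤1+n L))) many-copies

  long-path : ∀ c R → Q.Path (c ∷ R) → ∃ λ P → 𝔾.Path P × length (c ∷ R) + 2 * t ≤ length P
  long-path c R PR = via W W-attached fewer-than-copies
    where
    r = length (c ∷ R)
    via : ∀ ws → Attached ws → length ws < suc τ′ → ∃ λ P → 𝔾.Path P × r + 2 * length ws ≤ length P
    via [] _ _ = map (φ zero) (c ∷ R) , 𝔾.path (proj₁ lifted) (proj₂ lifted) (λ _ _ → refl) ,
                   ≤-reflexive (trans (+-identityʳ r) (sym (List.length-map (φ zero) (c ∷ R))))
      where lifted = lift zero PR
    via (w ∷ ws) A bound = P , PP , *-cancelˡ-≤ 2 (+-cancelʳ-≤ 2 _ _ (≤-trans (≤-reflexive (regroup r (length (w ∷ ws)))) long))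
      where
      woven = weave (Induced.half-path G (φ zero) (connected zero) c R PR) w ws bound A
      P = proj₁ woven
      PP = proj₁ (proj₂ woven)
      long = proj₂ (proj₂ woven)
      regroup : ∀ r m → 2 * (r + 2 * m) + 2 ≡ suc r + suc r + 4 * m
      regroup = solve-∀

  2t≤L : 2 * t ≤ L
  2t≤L = ≤-pred (≤-pred (≤-trans (s≤s (proj₂ (proj₂ found))) (≰⇒> λ long → no-long-path (proj₁ (proj₂ found)) long)))
    where found = long-path zero [] (Q.path (Distinct-[-] zero) [-] (λ _ _ → refl))

  p : ℕ
  p = L ∸ 2 * t

  p+2t≡L : p + 2 * t ≡ L
  p+2t≡L = m∸n+n≡m 2t≤L

  Q-path-free : Q.PathFreeOn (λ _ → true) (2 + p)
  Q-path-free (c ∷ R) PR long = no-long-path (proj₁ (proj₂ found))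
    (≤-trans (≤-reflexive (cong (2 +_) (sym p+2t≡L))) (≤-trans (+-monoˡ-≤ (2 * t) long) (proj₂ (proj₂ found))))
    where found = long-path c R PR

  open ErdősGallaiTheorem (induced G (φ zero))

  Q-extremal-bound : ErdősGallai p (λ _ → true)
  Q-extremal-bound = erdős-gallai p (λ _ → true) Q-path-free

  degSum≡inner : Q.degSum (λ _ → true) ≡ inner
  degSum≡inner = sum-cong-≗ {k} λ a → trans (+-identityʳ (Q.deg (λ _ → true) a))
                   (sum-cong-≗ {k} λ b → +-identityʳ (bit (adj G (φ zero a) (φ zero b))))

  card≡k : Q.card (λ _ → true) ≡ k
  card≡k = trans (sum-const k 1) (*-identityʳ k)

  edges≡ : 2 * (eIn G S + eOut G S) ≡ τ * (inner + 2 * leaving)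
  edges≡ = begin
    2 * (eIn G S + eOut G S)              ≡⟨ *-distribˡ-+ 2 (eIn G S) (eOut G S) ⟩
    2 * eIn G S + 2 * eOut G S            ≡⟨ cong₂ _+_ 2*eIn≡ (cong (2 *_) eOut≡) ⟩
    τ * inner + 2 * (τ * leaving)         ≡⟨ cong (τ * inner +_) (*-left-comm 2 τ leaving) ⟩
    τ * inner + τ * (2 * leaving)         ≡⟨ *-distribˡ-+ τ inner (2 * leaving) ⟨
    τ * (inner + 2 * leaving)             ∎
    where open ≡-Reasoning

  L*k≤ : L * k ≤ inner + 2 * leaving
  L*k≤ = *-cancelˡ-≤ τ (begin
    τ * (L * k)               ≡⟨ *-left-comm τ L k ⟩
    L * (τ * k)               ≡⟨ cong (L *_) ∣S∣≡τ*k ⟨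
    L * ∣ S ∣                 ≤⟨ dense ⟩
    2 * (eIn G S + eOut G S)  ≡⟨ edges≡ ⟩
    τ * (inner + 2 * leaving) ∎)
    where open ≤-Reasoning

  inner≤p*k : inner ≤ p * k
  inner≤p*k = subst₂ _≤_ degSum≡inner (cong (p *_) card≡k) (degSum≤ Q-extremal-bound)

  p*k+2tk≡L*k : p * k + 2 * (t * k) ≡ L * k
  p*k+2tk≡L*k = trans (regroup p t k) (cong (_* k) p+2t≡L)
    where
    regroup : ∀ p t k → p * k + 2 * (t * k) ≡ (p + 2 * t) * k
    regroup = solve-∀

  -- The density hypothesis bounds the edges at Q₁ from below, Erdős–Gallai and the t attached
  -- vertices from above, and the two bounds meet.
  squeeze : inner + 2 * leaving ≡ L * k
  squeeze = ≤-antisym (≤-trans (+-mono-≤ inner≤p*k (*-monoʳ-≤ 2 leaving≤t*k)) (≤-reflexive p*k+2tk≡L*k)) L*k≤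

  tight : inner ≡ p * k × 2 * leaving ≡ 2 * (t * k)
  tight = +-≤-equality inner≤p*k (*-monoʳ-≤ 2 leaving≤t*k) (trans squeeze (sym p*k+2tk≡L*k))

  Q-clique-union : CliqueUnion p (λ _ → true)
  Q-clique-union = extremal Q-extremal-bound (trans degSum≡inner (trans (proj₁ tight) (cong (p *_) (sym card≡k))))

  -- Q₁ is connected and its adjacency is transitive, so it is complete.
  Q-complete : ∀ {a b} → a ≢ b → Q.Adj a b
  Q-complete {a} {b} = along a b (connected zero a b)
    where
    along : ∀ a c → Reach G (φ zero) a c → a ≢ c → Q.Adj a c
    along a .a (here .a) a≢a = ⊥-elim (a≢a refl)
    along a c (step .a b .c a~b walk) a≢c with b Data.Fin.≟ c
    ... | yes refl = a~b
    ... | no b≢c = transitive Q-clique-union refl refl refl a~b (along b c walk b≢c) a≢c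

  k≡1+p : k ≡ suc p
  k≡1+p = begin
    k                               ≡⟨ card≡k ⟨
    Q.card (λ _ → true)              ≡⟨ complete⇒deg+1≡card {X = λ _ → true} refl (λ _ u≢0 → Q-complete (≢-sym u≢0)) ⟨
    Q.deg (λ _ → true) zero + 1      ≡⟨ cong (_+ 1) (regular Q-clique-union zero refl) ⟩
    p + 1                            ≡⟨ +-comm p 1 ⟩
    suc p                            ∎
    where open ≡-Reasoning

  balanced : 2 * (eIn G S + eOut G S) ≡ L * ∣ S ∣
  balanced = begin
    2 * (eIn G S + eOut G S)     ≡⟨ edges≡ ⟩
    τ * (inner + 2 * leaving)    ≡⟨ cong (τ *_) squeeze ⟩
    τ * (L * k)                  ≡⟨ *-left-comm τ L k ⟩
    L * (τ * k)                  ≡⟨ cong (L *_) ∣S∣≡τ*k ⟨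
    L * ∣ S ∣                    ∎
    where open ≡-Reasoning

  cliques : t ≡ 0 → AllCliques G (2 + L) S φ
  cliques t≡0 = k≡1+L , (λ i a b a≢b → trans (same-inside i zero a b) (Q-complete a≢b)) , eOut≡0
    where
    k≡1+L : k ≡ suc L
    k≡1+L = trans k≡1+p (cong suc (trans (sym (+-identityʳ p)) (trans (cong (λ m → p + 2 * m) (sym t≡0)) p+2t≡L)))
    eOut≡0 : eOut G S ≡ 0
    eOut≡0 = trans eOut≡ (trans (cong (τ *_) (n≤0⇒n≡0 (≤-trans leaving≤t*k (≤-reflexive (cong (_* k) t≡0))))) (*-zeroʳ τ))

  complete-ends : Ends (2 * k)
  complete-ends a with Q.complete-path Q-complete a
  ... | P , PP , P-ends , |P|≡k = P , PP , P-ends , ≤-reflexive (cong (2 *_) (sym |P|≡k))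

  -- With an attached vertex and k ≥ 2, Hamiltonian paths of the copies woven through the attached
  -- vertices give a path on 2k + 2t - 1 ≥ k + 2t + 1 = ℓ vertices.
  single-vertex : 1 ≤ t → k′ ≡ 0
  single-vertex 1≤t = via W W-attached fewer-than-copies refl 1≤t
    where
    via : ∀ ws → Attached ws → length ws < suc τ′ → length ws ≡ t → 1 ≤ length ws → k′ ≡ 0
    via (w ∷ ws) A bound |ws|≡t _ = n≤0⇒n≡0 (≮⇒≥ λ 1≤k′ →
      no-long-path (proj₁ (proj₂ woven)) (subst (_≤ length (proj₁ woven)) (sym ℓ≡) (arithmetic k t _ (s≤s 1≤k′) long)))
      where
      woven = weave complete-ends w ws bound A
      long : 2 * k + 2 * k + 4 * t ≤ 2 * length (proj₁ woven) + 2
      long = subst (λ l → 2 * k + 2 * k + 4 * l ≤ 2 * length (proj₁ woven) + 2) |ws|≡t (proj₂ (proj₂ woven))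
      ℓ≡ : 2 + L ≡ k + 2 * t + 1
      ℓ≡ = trans (cong (2 +_) (sym p+2t≡L)) (trans (shift p t) (cong (λ m → m + 2 * t + 1) (sym k≡1+p)))
        where
        shift : ∀ p t → 2 + (p + 2 * t) ≡ suc p + 2 * t + 1
        shift = solve-∀
      arithmetic : ∀ k t l → 2 ≤ k → 2 * k + 2 * k + 4 * t ≤ 2 * l + 2 → k + 2 * t + 1 ≤ l
      arithmetic k t l 2≤k long = *-cancelˡ-≤ 2 (+-cancelʳ-≤ 2 _ _ (begin
        2 * (k + 2 * t + 1) + 2      ≡⟨ e₁ k t ⟩
        4 + (2 * k + 4 * t)          ≤⟨ +-monoˡ-≤ (2 * k + 4 * t) (*-monoʳ-≤ 2 2≤k) ⟩
        2 * k + (2 * k + 4 * t)      ≡⟨ +-assoc (2 * k) (2 * k) (4 * t) ⟨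
        2 * k + 2 * k + 4 * t        ≤⟨ long ⟩
        2 * l + 2                    ∎))
        where
        open ≤-Reasoning
        e₁ : ∀ k t → 2 * (k + 2 * t + 1) + 2 ≡ 4 + (2 * k + 4 * t)
        e₁ = solve-∀

  attached⇒L≡2t : 1 ≤ t → L ≡ 2 * t
  attached⇒L≡2t 1≤t = trans (sym p+2t≡L) (cong (_+ 2 * t) (suc-injective (trans (sym k≡1+p) (cong suc (single-vertex 1≤t)))))

  odd-case : ∀ m → 2 + L ≡ 2 * m + 1 → AllCliques G (2 + L) S φ
  odd-case m ℓ≡ = [ cliques , (λ 1≤t → ⊥-elim (even≢odd (suc t) m (parity 1≤t))) ]′ (zero-or-positive t)
    where
    parity : 1 ≤ t → 2 * suc t ≡ suc (2 * m)
    parity 1≤t = trans (shift t) (trans (cong (2 +_) (sym (attached⇒L≡2t 1≤t))) (trans ℓ≡ (+-comm (2 * m) 1)))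
      where
      shift : ∀ t → 2 * suc t ≡ 2 + 2 * t
      shift = solve-∀

  even-case : ∀ m → 2 + L ≡ 2 * m + 2 → 4 ≤ 2 + L →
    AllCliques G (2 + L) S φ
    ⊎ ((k ≡ 1) × (Σ (Fin m → Fin n) λ w → (∀ j j′ → w j ≡ w j′ → j ≡ j′) × (∀ j → w j ∉ S)
                                         × (∀ j (i : Fin τ) (a : Fin k) → adj G (w j) (φ i a) ≡ true)))
  even-case m ℓ≡ _ = [ inj₁ ∘ cliques , (λ 1≤t → inj₂ (cong suc (single-vertex 1≤t) , witnesses 1≤t)) ]′ (zero-or-positive t)
    where
    open Attached W-attached
    witnesses : 1 ≤ t → Σ (Fin m → Fin n) λ w → (∀ j j′ → w j ≡ w j′ → j ≡ j′) × (∀ j → w j ∉ S)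
                                                × (∀ j (i : Fin τ) (a : Fin k) → adj G (w j) (φ i a) ≡ true)
    witnesses 1≤t = w , w-injective , w∉S , w-adjacent
      where
      m≡t : m ≡ t
      m≡t = sym (*-cancelˡ-≡ t m 2 (+-cancelʳ-≡ 2 (2 * t) (2 * m) (trans (+-comm (2 * t) 2) (trans (cong (2 +_) (sym (attached⇒L≡2t 1≤t))) ℓ≡))))
      w : Fin m → Fin n
      w j = lookup W (cast m≡t j)
      w∈W : ∀ j → w j ∈ᴸ W
      w∈W j = lookup-∈ W (cast m≡t j)
      w-injective : ∀ j j′ → w j ≡ w j′ → j ≡ j′
      w-injective j j′ eq = toℕ-injective (trans (sym (toℕ-cast m≡t j))
        (trans (cong toℕ (lookup-injective W attached-distinct _ _ eq)) (toℕ-cast m≡t j′)))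
      w∉S : ∀ j → w j ∉ S
      w∉S j w∈S = let i , a , φa≡w = inS⇒φ ([]=⇒lookup w∈S) in attached-outside (w j) (w∈W j) i a φa≡w
      w-adjacent : ∀ j i a → adj G (w j) (φ i a) ≡ true
      w-adjacent j i a = trans (symm G (w j) (φ i a)) (trans (same-outside i zero a (w j) (attached-outside (w j) (w∈W j)))
        (subst (λ b → adj G (φ zero b) (w j) ≡ true) (Fin1-unique (single-vertex 1≤t) (att (w j)) a) (attached-adjacent (w j) (w∈W j))))

lemma3p7 : (ℓ n : ℕ) (G : Graph n) (S : Subset n) (τ k : ℕ) (φ : Fin τ → Fin k → Fin n) →
    ℓ ≥ 3 → PathFree G ℓ →
    (ℓ ∸ 1) ∣ ∣ S ∣ →
    SymmetricFamily G τ k φ → IsUnionOf S φ → NoCrossEdges G φ →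
    τ ≥ ℓ →
    2 * (eIn G S + eOut G S) ≥ (ℓ ∸ 2) * ∣ S ∣ →
    (2 * (eIn G S + eOut G S) ≡ (ℓ ∸ 2) * ∣ S ∣)
    × (∀ m → ℓ ≡ 2 * m + 1 → AllCliques G ℓ S φ)
    × (∀ m → ℓ ≡ 2 * m + 2 → ℓ ≥ 4 →
         AllCliques G ℓ S φ
         ⊎ ((k ≡ 1)
            × (Σ (Fin m → Fin n) λ w →
                 (∀ j j' → w j ≡ w j' → j ≡ j')
                 × (∀ j → w j ∉ S)
                 × (∀ j (i : Fin τ) (a : Fin k) → adj G (w j) (φ i a) ≡ true))))
lemma3p7 _ _ _ _ zero _ _ (s≤s (s≤s (s≤s z≤n))) _ _ _ _ _ () _
lemma3p7 _ _ _ _ (suc _) zero _ (s≤s (s≤s (s≤s z≤n))) _ _ (() , _) _ _ _ _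
lemma3p7 .(3 + L) n G S (suc τ′) (suc k′) φ (s≤s (s≤s (s≤s {n = L} z≤n))) path-free _
  (_ , injective , connected , same-inside , same-outside) union no-cross many-copies dense =
  balanced , odd-case , even-case
  where
  open Lemma3p7 (suc L) n G S τ′ k′ φ path-free injective connected same-inside same-outside union no-cross many-copies dense
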